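{- Let $A$ be a linear $\{0,1\}$-matrix with $n$ columns and $g(A)\ge 5$, and suppose $G_A$ contains no odd hole. Then $A$ is balanced if and only if, for every $j\in\{1,\dots,n\}$, no member of $\mathcal{G}^{(j)}$ contains an odd hole.
   Context: A $\{0,1\}$-matrix is linear if it has no $2\times2$ all-ones submatrix; balanced if it has no square submatrix of odd order with exactly two 1's per row and per column. For $k\ge3$, $C_k$ is the $k\times k$ matrix with $c_{ij}=1$ iff $j\in\{i,i+1\}$ (mod $k$); matrices are congruent if one arises from the other by permuting rows and columns. $g(A)$ is the least odd $k$ such that $A$ has a submatrix congruent to $C_k$, and $g(A)=\infty$ if there is none. The intersection graph $G_{A}$ has the columns of $A$ as vertices, two adjacent iff some row has a 1 in both. A hole is an induced cycle of length at least 4, odd if its length is odd. For column $j$ of $A$, let $R_j$ be the set of rows of $A$ having a 1 in column $j$, $m_j=\#R_j$; $\mathcal{A}^{(j)}$ is the class of submatrices of $A$ obtained by deleting $m_j-2$ of the rows in $R_j$ (and keeping all columns), and $\mathcal{G}^{(j)}=\{G_{A'} : A'\in\mathcal{A}^{(j)}\}$. -}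

module Defs where

open import Data.Bool using (Bool; true; false)
open import Data.Nat using (ℕ; zero; suc; _*_; _∸_; _≤_)
open import Data.Fin using (Fin; toℕ)
open import Data.Fin.Subset using (Subset; _∈_; _∉_; _⊆_; ∣_∣; ∁)
open import Data.Vec using (tabulate)
open import Data.Product using (Σ; ∃; _×_; _,_)
open import Data.Sum using (_⊎_)
open import Function.Definitions using (Injective)
open import Relation.Binary.PropositionalEquality using (_≡_)
open import Relation.Nullary using (¬_)
open import Function.Bundles using (_⇔_)

Matrix : ℕ → ℕ → Set
Matrix m n = Fin m → Fin n → Bool

Odd : ℕ → Set
Odd k = ∃ λ t → k ≡ suc (2 * t)

Linear : ∀ {m n} → Matrix m n → Set
Linear {m} {n} A =
  ¬ (Σ (Fin m) λ i₁ → Σ (Fin m) λ i₂ → Σ (Fin n) λ j₁ → Σ (Fin n) λ j₂ →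
       ¬ (i₁ ≡ i₂) × ¬ (j₁ ≡ j₂) ×
       A i₁ j₁ ≡ true × A i₁ j₂ ≡ true × A i₂ j₁ ≡ true × A i₂ j₂ ≡ true)

ones : ∀ {k} → (Fin k → Bool) → ℕ
ones f = ∣ tabulate f ∣

-- A submatrix is given by injective row/column maps
-- (which also covers reorderings, harmless here).
Balanced : ∀ {m n} → Matrix m n → Set
Balanced {m} {n} A =
  ¬ (Σ ℕ λ k → Odd k × Σ (Fin k → Fin m) λ r → Σ (Fin k → Fin n) λ c →
       Injective _≡_ _≡_ r × Injective _≡_ _≡_ c ×
       (∀ i → ones (λ j → A (r i) (c j)) ≡ 2) ×
       (∀ j → ones (λ i → A (r i) (c j)) ≡ 2))

CkOne : (k : ℕ) → Fin k → Fin k → Set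
CkOne k i j = toℕ j ≡ toℕ i ⊎ toℕ j ≡ suc (toℕ i) ⊎ (suc (toℕ i) ≡ k × toℕ j ≡ 0)

-- A has a submatrix congruent to C_k (congruence = permuting rows/columns,
-- absorbed by allowing arbitrary injective row/column selections).
HasC : ∀ {m n} → Matrix m n → ℕ → Set
HasC {m} {n} A k =
  Σ (Fin k → Fin m) λ r → Σ (Fin k → Fin n) λ c →
    Injective _≡_ _≡_ r × Injective _≡_ _≡_ c ×
    (∀ i j → (A (r i) (c j) ≡ true) ⇔ CkOne k i j)

-- g(A) ≥ b, where g(A) is the least odd k ≥ 3 with a C_k submatrix (∞ if none):
-- every odd k ≥ 3 for which A has a submatrix congruent to C_k is ≥ b.
gAtLeast : ∀ {m n} → Matrix m n → ℕ → Set
gAtLeast A b = ∀ k → 3 ≤ k → Odd k → HasC A k → b ≤ k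

Graph : ℕ → Set₁
Graph n = Fin n → Fin n → Set

-- Intersection graph of the submatrix of A consisting of the rows in K
-- (all columns kept): columns j ≠ j' adjacent iff some kept row has a 1 in both.
IGrows : ∀ {m n} → Matrix m n → Subset m → Graph n
IGrows {m} A K j j' = ¬ (j ≡ j') × Σ (Fin m) λ i → i ∈ K × A i j ≡ true × A i j' ≡ true

IG : ∀ {m n} → Matrix m n → Graph n
IG {m} A j j' = ¬ (j ≡ j') × Σ (Fin m) λ i → A i j ≡ true × A i j' ≡ true

CycAdj : (ℓ : ℕ) → Fin ℓ → Fin ℓ → Set
CycAdj ℓ a b = toℕ b ≡ suc (toℕ a) ⊎ toℕ a ≡ suc (toℕ b)
             ⊎ (suc (toℕ a) ≡ ℓ × toℕ b ≡ 0) ⊎ (suc (toℕ b) ≡ ℓ × toℕ a ≡ 0)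

IsHole : ∀ {n} → Graph n → (ℓ : ℕ) → (Fin ℓ → Fin n) → Set
IsHole G ℓ v = 4 ≤ ℓ × Injective _≡_ _≡_ v ×
  (∀ a b → ¬ (a ≡ b) → (G (v a) (v b) ⇔ CycAdj ℓ a b))

HasOddHole : ∀ {n} → Graph n → Set
HasOddHole {n} G = Σ ℕ λ ℓ → Odd ℓ × Σ (Fin ℓ → Fin n) λ v → IsHole G ℓ v

R : ∀ {m n} → Matrix m n → Fin n → Subset m
R A j = tabulate λ i → A i j

-- A' ∈ 𝒜^(j) is determined by the set D ⊆ R_j of deleted rows, ∣ D ∣ = m_j - 2
-- (truncated subtraction); G_{A'} is then IGrows A (∁ D).

{-# OPTIONS --safe #-}
module Submission where

-- If A is balanced, so is every row-submatrix A', and an odd hole v₀ … v_{ℓ-1} of G_{A'} yields an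
-- odd C_ℓ in A: choose for each hole edge a row containing both ends; since the hole is induced,
-- these rows are distinct and meet the hole only in their edge.
--
-- Conversely, an unbalanced A contains an odd C_L (walk along the 2-regular submatrix witnessing
-- unbalancedness and discard even cycles). Take L minimal, so L ≥ 5. Call a row off the cycle that
-- meets two cycle columns a chord row. By minimality and linearity consecutive cycle columns of a
-- chord row are at odd distance, and a parity count on the cycle, coloured by two chord rows, shows
-- that any two chord rows share a cycle column. Three chord rows meeting pairwise but not jointly
-- would span a C_3, which linearity and g(A) ≥ 5 forbid; hence all chord rows share a cycle column
-- j, and deleting all rows of R_j but the two cycle rows leaves the cycle as an odd hole of a
-- member of 𝒢^(j).

open import Defs
open import Data.Bool using (Bool; true; false; not; _∧_; _∨_; _xor_)
open import Data.Bool.Properties using (∧-identityʳ; ∧-zeroʳ; ∨-zeroʳ; ∨-identityʳ; ∧-conicalˡ; ∧-conicalʳ; not-involutive; xor-same; not-distribˡ-xor; xor-identityʳ; ¬-not)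
open import Data.Nat as ℕ using (ℕ; zero; suc; _+_; _*_; _∸_; _≤_; _<_; z≤n; s≤s; _/_; _%_)
open import Data.Nat.Properties
open import Data.Nat.DivMod using (m%n<n; m≡m%n+[m/n]*n; [m+kn]%n≡m%n; m<n⇒m%n≡m; n%n≡0; [m+n]%n≡m%n; %-distribˡ-+; m%n%n≡m%n)
open import Data.Nat.Tactic.RingSolver
open import Data.Nat.Induction using (<-rec)
open import Data.Fin as F using (Fin; toℕ)
import Data.Fin.Properties as FP
open import Data.Fin.Subset using (Subset; _∈_; _⊆_; ∣_∣; ∁)
open import Data.Vec using (Vec; tabulate; lookup; _∷_; map)
open import Data.Vec.Properties using (lookup∘tabulate; []=⇒lookup; lookup⇒[]=; lookup-map)
open import Data.Product using (Σ; ∃; _×_; _,_; proj₁; proj₂; swap)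
open import Data.Sum using (_⊎_; inj₁; inj₂)
open import Data.Empty using (⊥; ⊥-elim)
open import Relation.Binary.PropositionalEquality
open import Relation.Binary.Definitions using (tri<; tri≈; tri>)
open import Relation.Nullary using (¬_; Dec; yes; no)
open import Relation.Nullary.Decidable using (⌊_⌋; _⊎-dec_; _×-dec_)
open import Function.Bundles using (_⇔_; mk⇔; Equivalence)
open import Function.Definitions using (Injective)
open Equivalence using (to; from)

-- Counting and parity

true≢false : true ≡ false → ⊥
true≢false ()

not≡true⇒≡false : ∀ {a} → not a ≡ true → a ≡ false
not≡true⇒≡false {false} _ = refl

Bool-cases : ∀ {X : Set} b → (b ≡ true → X) → (b ≡ false → X) → X
Bool-cases true t f = t refl
Bool-cases false t f = f refl

∧-intro : ∀ {a b} → a ≡ true → b ≡ true → a ∧ b ≡ true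
∧-intro refl refl = refl

∧-not-irrelevant : ∀ a b c → ((a ∧ b) ≡ true → c ≡ false) → ((a ∧ not c) ∧ b) ≡ (a ∧ b)
∧-not-irrelevant true true c h rewrite h refl = refl
∧-not-irrelevant true false c h = ∧-zeroʳ (not c)
∧-not-irrelevant false b c h = refl

_==_ : ∀ {k} → Fin k → Fin k → Bool
a == b = ⌊ a F.≟ b ⌋

==-refl : ∀ {k} (a : Fin k) → (a == a) ≡ true
==-refl a with a F.≟ a
... | yes _ = refl
... | no a≢a = ⊥-elim (a≢a refl)

==⇒≡ : ∀ {k} (a b : Fin k) → (a == b) ≡ true → a ≡ b
==⇒≡ a b _ with a F.≟ b
... | yes a≡b = a≡b

≢⇒==false : ∀ {k} (a b : Fin k) → ¬ (a ≡ b) → (a == b) ≡ false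
≢⇒==false a b a≢b with a F.≟ b
... | yes a≡b = ⊥-elim (a≢b a≡b)
... | no _ = refl

bit : Bool → ℕ
bit true = 1
bit false = 0

count : ∀ {k} → (Fin k → Bool) → ℕ
count {zero} f = 0
count {suc k} f = bit (f F.zero) + count (λ x → f (F.suc x))

ones≡count : ∀ {k} (f : Fin k → Bool) → ones f ≡ count f
ones≡count {zero} f = refl
ones≡count {suc k} f = trans (∣∷∣ (f F.zero) (tabulate (λ x → f (F.suc x)))) (cong (bit (f F.zero) +_) (ones≡count (λ x → f (F.suc x))))
  where
    ∣∷∣ : ∀ {k} (b : Bool) (xs : Vec Bool k) → ∣ b ∷ xs ∣ ≡ bit b + ∣ xs ∣
    ∣∷∣ true xs = refl
    ∣∷∣ false xs = refl

∈-tabulate⁻ : ∀ {k} (f : Fin k → Bool) x → x ∈ tabulate f → f x ≡ true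
∈-tabulate⁻ f x p = trans (sym (lookup∘tabulate f x)) ([]=⇒lookup p)

∈-tabulate⁺ : ∀ {k} (f : Fin k → Bool) x → f x ≡ true → x ∈ tabulate f
∈-tabulate⁺ f x p = lookup⇒[]= x (tabulate f) (trans (lookup∘tabulate f x) p)

∈-∁-tabulate⁻ : ∀ {k} (f : Fin k → Bool) x → x ∈ ∁ (tabulate f) → f x ≡ false
∈-∁-tabulate⁻ f x p = not≡true⇒≡false (begin
  not (f x)                     ≡⟨ cong not (lookup∘tabulate f x) ⟨
  not (lookup (tabulate f) x)   ≡⟨ lookup-map x not (tabulate f) ⟨
  lookup (∁ (tabulate f)) x     ≡⟨ []=⇒lookup p ⟩
  true                          ∎)
  where
    open ≡-Reasoning

∈-∁-tabulate⁺ : ∀ {k} (f : Fin k → Bool) x → f x ≡ false → x ∈ ∁ (tabulate f)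
∈-∁-tabulate⁺ f x p = lookup⇒[]= x (map not (tabulate f))
  (trans (lookup-map x not (tabulate f)) (cong not (trans (lookup∘tabulate f x) p)))

count-cong : ∀ {k} (f g : Fin k → Bool) → (∀ x → f x ≡ g x) → count f ≡ count g
count-cong {zero} f g f≗g = refl
count-cong {suc k} f g f≗g = cong₂ _+_ (cong bit (f≗g F.zero)) (count-cong _ _ (λ x → f≗g (F.suc x)))

count-all : ∀ k → count {k} (λ _ → true) ≡ k
count-all zero = refl
count-all (suc k) = cong suc (count-all k)

count-none : ∀ {k} (f : Fin k → Bool) → (∀ x → f x ≡ false) → count f ≡ 0
count-none {zero} f none = refl
count-none {suc k} f none rewrite none F.zero = count-none _ (λ x → none (F.suc x))

count>0⇒∃ : ∀ {k} (f : Fin k → Bool) → 0 < count f → ∃ λ x → f x ≡ true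
count>0⇒∃ {suc k} f pos with f F.zero in eq
... | true = F.zero , eq
... | false with count>0⇒∃ (λ x → f (F.suc x)) pos
... | x , fx = F.suc x , fx

count-remove : ∀ {k} (f : Fin k → Bool) r → f r ≡ true → count f ≡ suc (count (λ i → f i ∧ not (i == r)))
count-remove {suc k} f F.zero fr rewrite fr = cong suc (count-cong (λ x → f (F.suc x)) _ (λ x → sym (∧-identityʳ _)))
count-remove {suc k} f (F.suc r) fr =
  trans (cong (bit (f F.zero) +_) (count-remove (λ x → f (F.suc x)) r fr))
        (trans (+-suc (bit (f F.zero)) _)
               (cong suc (cong₂ _+_ (cong bit (sym (∧-identityʳ _))) (count-cong (λ x → f (F.suc x) ∧ not (x == r)) _ λ x → cong (λ b → f (F.suc x) ∧ not b) (==-suc x r)))))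
  where
    ==-suc : ∀ {k} (a b : Fin k) → (a == b) ≡ (F.suc a == F.suc b)
    ==-suc a b with a F.≟ b
    ... | yes _ = refl
    ... | no _ = refl

without⁺ : ∀ {k} (f : Fin k → Bool) {r i} → f i ≡ true → ¬ (i ≡ r) → (f i ∧ not (i == r)) ≡ true
without⁺ f {r} {i} fi i≢r = ∧-intro fi (cong not (≢⇒==false i r i≢r))

without⁻ : ∀ {k} (f : Fin k → Bool) {r i} → (f i ∧ not (i == r)) ≡ true → ¬ (i ≡ r)
without⁻ f {r} {i} h refl = true≢false (trans (sym (∧-conicalʳ _ _ h)) (cong not (==-refl i)))

count≡0⇒false : ∀ {k} (f : Fin k → Bool) → count f ≡ 0 → ∀ x → f x ≡ true → ⊥
count≡0⇒false f c x fx with trans (sym c) (count-remove f x fx)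
... | ()

module _ {k} (f : Fin k → Bool) where

  private
    without : Fin k → Fin k → Bool
    without r i = f i ∧ not (i == r)

  count≡2⇒another : ∀ a → count f ≡ 2 → f a ≡ true → ∃ λ b → ¬ (b ≡ a) × f b ≡ true
  count≡2⇒another a c fa
    with count>0⇒∃ (without a) (subst (0 <_) (suc-injective (trans (sym c) (count-remove f a fa))) (s≤s z≤n))
  ... | b , h = b , without⁻ f h , ∧-conicalˡ _ _ h

  count≡2⇒one-of : ∀ a b x → count f ≡ 2 → f a ≡ true → f b ≡ true → ¬ (a ≡ b) →
                    f x ≡ true → x ≡ a ⊎ x ≡ b
  count≡2⇒one-of a b x c fa fb a≢b fx with x F.≟ a | x F.≟ b
  ... | yes x≡a | _ = inj₁ x≡a
  ... | no _ | yes x≡b = inj₂ x≡b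
  ... | no x≢a | no x≢b = ⊥-elim (count≡0⇒false (λ i → without a i ∧ not (i == b)) c₀ x (without⁺ (without a) (without⁺ f fx x≢a) x≢b))
    where
      c₀ : count (λ i → without a i ∧ not (i == b)) ≡ 0
      c₀ = suc-injective (suc-injective (begin
        suc (suc (count (λ i → without a i ∧ not (i == b))))
          ≡⟨ cong suc (count-remove (without a) b (without⁺ f fb (λ b≡a → a≢b (sym b≡a)))) ⟨
        suc (count (without a))   ≡⟨ count-remove f a fa ⟨
        count f                   ≡⟨ c ⟩
        2                         ∎))
        where
          open ≡-Reasoning

  count-two : ∀ a b → ¬ (a ≡ b) → f a ≡ true → f b ≡ true → (∀ x → f x ≡ true → x ≡ a ⊎ x ≡ b) → count f ≡ 2
  count-two a b a≢b fa fb only = begin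
    count f                                        ≡⟨ count-remove f a fa ⟩
    suc (count (without a))                        ≡⟨ cong suc (count-remove (without a) b (without⁺ f fb (λ b≡a → a≢b (sym b≡a)))) ⟩
    2 + count (λ i → without a i ∧ not (i == b))   ≡⟨ cong (2 +_) (count-none _ none) ⟩
    2                                              ∎
    where
      open ≡-Reasoning
      none : ∀ x → (without a x ∧ not (x == b)) ≡ false
      none x with f x in fx
      ... | false = refl
      ... | true with only x fx
      ... | inj₁ refl rewrite ==-refl x = refl
      ... | inj₂ refl rewrite ==-refl x = ∧-zeroʳ _

isOdd : ℕ → Bool
isOdd zero = false
isOdd (suc n) = not (isOdd n)

isOdd-+ : ∀ m n → isOdd (m + n) ≡ isOdd m xor isOdd n
isOdd-+ zero n = refl
isOdd-+ (suc m) n = trans (cong not (isOdd-+ m n)) (not-distribˡ-xor (isOdd m) (isOdd n))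

Odd⇒isOdd : ∀ {k} → Odd k → isOdd k ≡ true
Odd⇒isOdd (t , refl) = cong not (begin
  isOdd (t + (t + 0))          ≡⟨ cong (λ u → isOdd (t + u)) (+-identityʳ t) ⟩
  isOdd (t + t)                ≡⟨ isOdd-+ t t ⟩
  isOdd t xor isOdd t          ≡⟨ xor-same (isOdd t) ⟩
  false                        ∎)
  where
    open ≡-Reasoning

isOdd⇒Odd : ∀ k → isOdd k ≡ true → Odd k
isOdd⇒Odd (suc zero) _ = 0 , refl
isOdd⇒Odd (suc (suc k)) h with isOdd⇒Odd k (trans (sym (not-involutive (isOdd k))) h)
... | t , refl = suc t , cong (λ u → suc (suc u)) (sym (+-suc t (t + 0)))

even-pos⇒2≤ : ∀ k → 0 < k → isOdd k ≡ false → 2 ≤ k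
even-pos⇒2≤ (suc (suc _)) _ _ = s≤s (s≤s z≤n)

odd-2≤⇒3≤ : ∀ k → 2 ≤ k → isOdd k ≡ true → 3 ≤ k
odd-2≤⇒3≤ (suc zero) (s≤s ()) _
odd-2≤⇒3≤ (suc (suc (suc _))) _ _ = s≤s (s≤s (s≤s z≤n))

private
  xor≡true⇒≡not : ∀ a b → a xor b ≡ true → a ≡ not b
  xor≡true⇒≡not true b h = sym h
  xor≡true⇒≡not false b h = cong not (sym h)

  not-xor-self : ∀ a → not a xor a ≡ true
  not-xor-self true = refl
  not-xor-self false = refl

  odd-sum : ∀ m n → isOdd (m + n) ≡ true → isOdd m ≡ not (isOdd n)
  odd-sum m n h = xor≡true⇒≡not (isOdd m) (isOdd n) (trans (sym (isOdd-+ m n)) h)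

  odd-from : ∀ m n → isOdd m ≡ not (isOdd n) → isOdd (m + n) ≡ true
  odd-from m n h = trans (isOdd-+ m n) (trans (cong (_xor isOdd n) h) (not-xor-self (isOdd n)))

isOdd-skip-even : ∀ a b c → isOdd (a + (b + c)) ≡ true → isOdd b ≡ false → isOdd (a + c) ≡ true
isOdd-skip-even a b c h b-even = odd-from a c (begin
  isOdd a                      ≡⟨ odd-sum a (b + c) h ⟩
  not (isOdd (b + c))          ≡⟨ cong not (isOdd-+ b c) ⟩
  not (isOdd b xor isOdd c)    ≡⟨ cong (λ x → not (x xor isOdd c)) b-even ⟩
  not (isOdd c)                ∎)
  where
    open ≡-Reasoning

isOdd-bridge : ∀ a b c d → isOdd (a + b) ≡ true → isOdd (b + (c + d)) ≡ true → isOdd c ≡ true →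
               isOdd (a + d) ≡ true
isOdd-bridge a b c d h₁ h₂ c-odd = odd-from a d (begin
  isOdd a                      ≡⟨ odd-sum a b h₁ ⟩
  not (isOdd b)                ≡⟨ cong not (odd-sum b (c + d) h₂) ⟩
  not (not (isOdd (c + d)))    ≡⟨ not-involutive _ ⟩
  isOdd (c + d)                ≡⟨ isOdd-+ c d ⟩
  isOdd c xor isOdd d          ≡⟨ cong (_xor isOdd d) c-odd ⟩
  not (isOdd d)                ∎)
  where
    open ≡-Reasoning

isOdd-chain : ∀ a b c d → isOdd (a + b) ≡ true → isOdd (b + c) ≡ true → isOdd (c + d) ≡ true →
              isOdd (a + d) ≡ true
isOdd-chain a b c d h₁ h₂ h₃ = odd-from a d (begin
  isOdd a                      ≡⟨ odd-sum a b h₁ ⟩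
  not (isOdd b)                ≡⟨ cong not (odd-sum b c h₂) ⟩
  not (not (isOdd c))          ≡⟨ not-involutive _ ⟩
  isOdd c                      ≡⟨ odd-sum c d h₃ ⟩
  not (isOdd d)                ∎)
  where
    open ≡-Reasoning

least-witness : (Q : ℕ → Bool) (n : ℕ) → Q n ≡ true →
                Σ ℕ λ k → k ≤ n × Q k ≡ true × (∀ j → j < k → Q j ≡ false)
least-witness Q zero q = 0 , z≤n , q , (λ j ())
least-witness Q (suc n) q with Q 0 in q₀
... | true = 0 , z≤n , q₀ , (λ j ())
... | false with least-witness (λ j → Q (suc j)) n q
... | k , k≤n , qk , below = suc k , s≤s k≤n , qk , below′
  where
    below′ : ∀ j → j < suc k → Q j ≡ false
    below′ zero _ = q₀
    below′ (suc j) (s≤s j<k) = below j j<k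

greatest-witness : (Q : ℕ → Bool) (n : ℕ) → Q 0 ≡ true →
                   Σ ℕ λ k → k ≤ n × Q k ≡ true × (∀ j → k < j → j ≤ n → Q j ≡ false)
greatest-witness Q zero q = 0 , z≤n , q , (λ j k<j j≤0 → ⊥-elim (<-irrefl refl (<-≤-trans k<j j≤0)))
greatest-witness Q (suc n) q with Q (suc n) in qn
... | true = suc n , ≤-refl , qn , (λ j n<j j≤n → ⊥-elim (<-irrefl refl (<-≤-trans n<j j≤n)))
... | false with greatest-witness Q n q
... | k , k≤n , qk , above = k , m≤n⇒m≤1+n k≤n , qk , above′
  where
    above′ : ∀ j → k < j → j ≤ suc n → Q j ≡ false
    above′ j k<j j≤1+n with m≤n⇒m<n∨m≡n j≤1+n
    ... | inj₁ (s≤s j≤n) = above j k<j j≤n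
    ... | inj₂ refl = qn

anyBelow : ℕ → (ℕ → Bool) → Bool
anyBelow zero f = false
anyBelow (suc n) f = anyBelow n f ∨ f n

anyBelow⁺ : ∀ n f x → x < n → f x ≡ true → anyBelow n f ≡ true
anyBelow⁺ (suc n) f x x<1+n fx with m≤n⇒m<n∨m≡n (≤-pred x<1+n)
... | inj₁ x<n rewrite anyBelow⁺ n f x x<n fx = refl
... | inj₂ refl rewrite fx = ∨-zeroʳ (anyBelow x f)

anyBelow⁻ : ∀ n f → anyBelow n f ≡ true → ∃ λ x → x < n × f x ≡ true
anyBelow⁻ (suc n) f h with anyBelow n f in below
... | true = let (x , x<n , fx) = anyBelow⁻ n f below in x , m≤n⇒m≤1+n x<n , fx
... | false = n , n<1+n n , h

anyBelow-none : ∀ n f → (∀ x → x < n → f x ≡ false) → anyBelow n f ≡ false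
anyBelow-none zero f none = refl
anyBelow-none (suc n) f none rewrite anyBelow-none n f (λ x x<n → none x (m≤n⇒m≤1+n x<n)) = none n (n<1+n n)

count-split : ∀ {k} (f g : Fin k → Bool) → count f ≡ count (λ x → f x ∧ not (g x)) + count (λ x → f x ∧ g x)
count-split {zero} f g = refl
count-split {suc k} f g with f F.zero | g F.zero
... | true | true = trans (cong suc (count-split (λ x → f (F.suc x)) (λ x → g (F.suc x)))) (sym (+-suc _ _))
... | true | false = cong suc (count-split (λ x → f (F.suc x)) (λ x → g (F.suc x)))
... | false | true = count-split (λ x → f (F.suc x)) (λ x → g (F.suc x))
... | false | false = count-split (λ x → f (F.suc x)) (λ x → g (F.suc x))

count-insert : ∀ {k} (f : Fin k → Bool) a → f a ≡ false → count (λ j → f j ∨ (a == j)) ≡ suc (count f)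
count-insert f a fa = trans (count-remove (λ j → f j ∨ (a == j)) a fa∨)
                            (cong suc (count-cong (λ j → (f j ∨ (a == j)) ∧ not (j == a)) f removed))
  where
    fa∨ : (f a ∨ (a == a)) ≡ true
    fa∨ rewrite ==-refl a = ∨-zeroʳ (f a)
    removed : ∀ j → ((f j ∨ (a == j)) ∧ not (j == a)) ≡ f j
    removed j with j F.≟ a
    ... | yes refl rewrite ==-refl j | fa = refl
    ... | no j≢a rewrite ≢⇒==false a j (λ a≡j → j≢a (sym a≡j)) = trans (∧-identityʳ (f j ∨ false)) (∨-identityʳ (f j))

count-image : ∀ {k} (f : ℕ → Fin k) T → (∀ x y → x < y → y < T → ¬ (f x ≡ f y)) →
              count (λ j → anyBelow T (λ x → f x == j)) ≡ T
count-image {k} f zero _ = count-none {k} _ (λ _ → refl)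
count-image f (suc T) distinct =
  trans (count-insert (λ j → anyBelow T (λ x → f x == j)) (f T)
                      (anyBelow-none T _ (λ x x<T → ≢⇒==false (f x) (f T) (distinct x T x<T (n<1+n T)))))
        (cong suc (count-image f T (λ x y x<y y<T → distinct x y x<y (m≤n⇒m≤1+n y<T))))

-- Submatrices congruent to C_L

CycSucc : ℕ → ℕ → ℕ → Set
CycSucc ℓ x y = y ≡ suc x ⊎ (suc x ≡ ℓ × y ≡ 0)

CycSucc-asym : ∀ ℓ a b → 3 ≤ ℓ → CycSucc ℓ a b → CycSucc ℓ b a → ⊥
CycSucc-asym ℓ a b 3≤ℓ (inj₁ refl) (inj₁ q) = <-irrefl q (<-trans (n<1+n a) (n<1+n (suc a)))
CycSucc-asym ℓ a b 3≤ℓ (inj₁ refl) (inj₂ (refl , refl)) with 3≤ℓ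
... | s≤s (s≤s ())
CycSucc-asym ℓ a b 3≤ℓ (inj₂ (refl , refl)) (inj₁ refl) with 3≤ℓ
... | s≤s (s≤s ())
CycSucc-asym ℓ a b 3≤ℓ (inj₂ (refl , refl)) (inj₂ (_ , refl)) with 3≤ℓ
... | s≤s ()

CycSucc-no-triangle : ∀ ℓ a b c → 4 ≤ ℓ → CycSucc ℓ a b → CycSucc ℓ b c → CycSucc ℓ c a → ⊥
CycSucc-no-triangle ℓ a b c 4≤ℓ (inj₁ refl) (inj₁ refl) (inj₁ q) = <-irrefl q (<-trans (n<1+n a) (<-trans (n<1+n (suc a)) (n<1+n (suc (suc a)))))
CycSucc-no-triangle ℓ a b c 4≤ℓ (inj₁ refl) (inj₁ refl) (inj₂ (refl , refl)) with 4≤ℓ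
... | s≤s (s≤s (s≤s ()))
CycSucc-no-triangle ℓ a b c 4≤ℓ (inj₁ refl) (inj₂ (refl , refl)) (inj₁ refl) with 4≤ℓ
... | s≤s (s≤s (s≤s ()))
CycSucc-no-triangle ℓ a b c 4≤ℓ (inj₁ refl) (inj₂ (refl , refl)) (inj₂ (_ , refl)) with 4≤ℓ
... | s≤s (s≤s ())
CycSucc-no-triangle ℓ a b c 4≤ℓ (inj₂ (refl , refl)) (inj₁ refl) (inj₁ refl) with 4≤ℓ
... | s≤s (s≤s (s≤s ()))
CycSucc-no-triangle ℓ a b c 4≤ℓ (inj₂ (refl , refl)) (inj₁ refl) (inj₂ (_ , refl)) with 4≤ℓ
... | s≤s ()
CycSucc-no-triangle ℓ a b c 4≤ℓ (inj₂ (refl , refl)) (inj₂ (refl , refl)) _ with 4≤ℓ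
... | s≤s ()

CkOneℕ : ℕ → ℕ → ℕ → Set
CkOneℕ L i j = j ≡ i ⊎ CycSucc L i j

injective-below : ∀ {X : Set} {L : ℕ} (f : ℕ → X) → (∀ i j → i < j → j < L → ¬ (f i ≡ f j)) →
                  ∀ {a b : Fin L} → f (toℕ a) ≡ f (toℕ b) → a ≡ b
injective-below f distinct {a} {b} e with <-cmp (toℕ a) (toℕ b)
... | tri< a<b _ _ = ⊥-elim (distinct _ _ a<b (FP.toℕ<n b) e)
... | tri≈ _ a≡b _ = FP.toℕ-injective a≡b
... | tri> _ _ b<a = ⊥-elim (distinct _ _ b<a (FP.toℕ<n a) (sym e))

HasC-fromℕ : ∀ {m n} (A : Matrix m n) L (row : ℕ → Fin m) (col : ℕ → Fin n) →
  (∀ i j → i < j → j < L → ¬ (row i ≡ row j)) →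
  (∀ i j → i < j → j < L → ¬ (col i ≡ col j)) →
  (∀ i j → i < L → j < L → A (row i) (col j) ≡ true → CkOneℕ L i j) →
  (∀ i → i < L → A (row i) (col i) ≡ true) →
  (∀ i → suc i < L → A (row i) (col (suc i)) ≡ true) →
  (∀ i → suc i ≡ L → A (row i) (col 0) ≡ true) →
  HasC A L
HasC-fromℕ A L row col row-distinct col-distinct only diag succ wrap =
  (λ t → row (toℕ t)) , (λ t → col (toℕ t)) , injective-below row row-distinct , injective-below col col-distinct ,
  λ i j → mk⇔ (only (toℕ i) (toℕ j) (FP.toℕ<n i) (FP.toℕ<n j)) (hit i j)
  where
    hit : ∀ i j → CkOne L i j → A (row (toℕ i)) (col (toℕ j)) ≡ true
    hit i j (inj₁ e) rewrite e = diag (toℕ i) (FP.toℕ<n i)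
    hit i j (inj₂ (inj₁ e)) rewrite e = succ (toℕ i) (subst (_< L) e (FP.toℕ<n j))
    hit i j (inj₂ (inj₂ (e , e0))) rewrite e0 = wrap (toℕ i) e

cyc-next : ℕ → ℕ → ℕ
cyc-next L i with suc i ℕ.<? L
... | yes _ = suc i
... | no _ = 0

cyc-next-cases : ∀ L i → i < L → (cyc-next L i ≡ suc i × suc i < L) ⊎ (cyc-next L i ≡ 0 × suc i ≡ L)
cyc-next-cases L i i<L with suc i ℕ.<? L
... | yes 1+i<L = inj₁ (refl , 1+i<L)
... | no 1+i≮L = inj₂ (refl , ≤-antisym i<L (≮⇒≥ 1+i≮L))

cyc-next< : ∀ L i → i < L → cyc-next L i < L
cyc-next< L i i<L with cyc-next-cases L i i<L
... | inj₁ (e , 1+i<L) = subst (_< L) (sym e) 1+i<L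
... | inj₂ (e , _) = subst (_< L) (sym e) (<-≤-trans (s≤s z≤n) i<L)

cyc-next-asym : ∀ L i j → 3 ≤ L → i < j → j < L → j ≡ cyc-next L i → i ≡ cyc-next L j → ⊥
cyc-next-asym L i j 3≤L i<j j<L j≡ i≡ with cyc-next-cases L i (<-trans i<j j<L) | cyc-next-cases L j j<L
... | inj₂ (e , _) | _ = <-irrefl (sym (trans j≡ e)) (≤-<-trans z≤n i<j)
... | inj₁ (e , _) | inj₁ (e′ , _) = <-irrefl (trans i≡ e′) (<-trans i<j (n<1+n j))
... | inj₁ (e , _) | inj₂ (e′ , 1+j≡L) = <-irrefl refl (<-≤-trans (s≤s (s≤s (s≤s z≤n))) (≤-trans 3≤L (≤-reflexive L≡2)))
  where
    L≡2 : L ≡ 2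
    L≡2 = trans (sym 1+j≡L) (cong suc (trans j≡ (trans e (cong suc (trans i≡ e′)))))

cyc-next-irreflexive : ∀ L j → j < L → 2 ≤ L → ¬ (cyc-next L j ≡ j)
cyc-next-irreflexive L j j<L 2≤L h with cyc-next-cases L j j<L
... | inj₁ (e , _) = <-irrefl (trans (sym h) e) (n<1+n j)
... | inj₂ (e , 1+j≡L) = <-irrefl refl (<-≤-trans 2≤L (≤-reflexive (trans (sym 1+j≡L) (cong suc (trans (sym h) e)))))

HasC-from-cyc-next : ∀ {m n} (A : Matrix m n) L (row : ℕ → Fin m) (col : ℕ → Fin n) →
  (∀ i j → i < j → j < L → ¬ (row i ≡ row j)) →
  (∀ i j → i < j → j < L → ¬ (col i ≡ col j)) →
  (∀ i j → i < L → j < L → A (row i) (col j) ≡ true → j ≡ i ⊎ j ≡ cyc-next L i) →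
  (∀ i → i < L → A (row i) (col i) ≡ true × A (row i) (col (cyc-next L i)) ≡ true) →
  HasC A L
HasC-from-cyc-next A L row col row-distinct col-distinct only hits =
  HasC-fromℕ A L row col row-distinct col-distinct only′ (λ i i<L → proj₁ (hits i i<L)) succ wrap
  where
    only′ : ∀ i j → i < L → j < L → A (row i) (col j) ≡ true → CkOneℕ L i j
    only′ i j i<L j<L h with only i j i<L j<L h | cyc-next-cases L i i<L
    ... | inj₁ j≡i | _ = inj₁ j≡i
    ... | inj₂ j≡ | inj₁ (e , _) = inj₂ (inj₁ (trans j≡ e))
    ... | inj₂ j≡ | inj₂ (e , 1+i≡L) = inj₂ (inj₂ (1+i≡L , trans j≡ e))
    succ : ∀ i → suc i < L → A (row i) (col (suc i)) ≡ true
    succ i 1+i<L with cyc-next-cases L i (<-trans (n<1+n i) 1+i<L) | proj₂ (hits i (<-trans (n<1+n i) 1+i<L))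
    ... | inj₁ (e , _) | h = subst (λ z → A (row i) (col z) ≡ true) e h
    ... | inj₂ (_ , 1+i≡L) | _ = ⊥-elim (<-irrefl 1+i≡L 1+i<L)
    wrap : ∀ i → suc i ≡ L → A (row i) (col 0) ≡ true
    wrap i 1+i≡L with cyc-next-cases L i (subst (i <_) 1+i≡L (n<1+n i)) | proj₂ (hits i (subst (i <_) 1+i≡L (n<1+n i)))
    ... | inj₂ (e , _) | h = subst (λ z → A (row i) (col z) ≡ true) e h
    ... | inj₁ (_ , 1+i<L) | _ = ⊥-elim (<-irrefl 1+i≡L 1+i<L)

cyc-next-mid : ∀ L i → suc i < L → cyc-next L i ≡ suc i
cyc-next-mid L i 1+i<L with cyc-next-cases L i (<-trans (n<1+n i) 1+i<L)
... | inj₁ (e , _) = e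
... | inj₂ (_ , 1+i≡L) = ⊥-elim (<-irrefl 1+i≡L 1+i<L)

cyc-next-last : ∀ L i → suc i ≡ L → cyc-next L i ≡ 0
cyc-next-last L i 1+i≡L with cyc-next-cases L i (subst (i <_) 1+i≡L (n<1+n i))
... | inj₂ (e , _) = e
... | inj₁ (_ , 1+i<L) = ⊥-elim (<-irrefl 1+i≡L 1+i<L)

triangle⇒HasC3 : ∀ {m n} (A : Matrix m n) (x y z : Fin m) (c₀ c₁ c₂ : Fin n) →
  ¬ (x ≡ y) → ¬ (x ≡ z) → ¬ (y ≡ z) → ¬ (c₀ ≡ c₁) → ¬ (c₀ ≡ c₂) → ¬ (c₁ ≡ c₂) →
  A x c₀ ≡ true → A x c₁ ≡ true → A x c₂ ≡ false →
  A y c₀ ≡ false → A y c₁ ≡ true → A y c₂ ≡ true →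
  A z c₀ ≡ true → A z c₁ ≡ false → A z c₂ ≡ true →
  HasC A 3
triangle⇒HasC3 {m} {n} A x y z c₀ c₁ c₂ x≢y x≢z y≢z c₀≢c₁ c₀≢c₂ c₁≢c₂ x₀ x₁ x₂ y₀ y₁ y₂ z₀ z₁ z₂ =
  HasC-fromℕ A 3 row col row-distinct col-distinct only diag succ wrap
  where
    row : ℕ → Fin m
    row 0 = x
    row 1 = y
    row _ = z
    col : ℕ → Fin n
    col 0 = c₀
    col 1 = c₁
    col _ = c₂
    row-distinct : ∀ i j → i < j → j < 3 → ¬ (row i ≡ row j)
    row-distinct 0 1 _ _ = x≢y
    row-distinct 0 2 _ _ = x≢z
    row-distinct 1 2 _ _ = y≢z
    row-distinct _ 0 () _
    row-distinct 1 1 (s≤s ()) _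
    row-distinct (suc (suc _)) 1 (s≤s ()) _
    row-distinct (suc (suc _)) 2 (s≤s (s≤s ())) _
    row-distinct _ (suc (suc (suc _))) _ (s≤s (s≤s (s≤s ())))
    col-distinct : ∀ i j → i < j → j < 3 → ¬ (col i ≡ col j)
    col-distinct 0 1 _ _ = c₀≢c₁
    col-distinct 0 2 _ _ = c₀≢c₂
    col-distinct 1 2 _ _ = c₁≢c₂
    col-distinct _ 0 () _
    col-distinct 1 1 (s≤s ()) _
    col-distinct (suc (suc _)) 1 (s≤s ()) _
    col-distinct (suc (suc _)) 2 (s≤s (s≤s ())) _
    col-distinct _ (suc (suc (suc _))) _ (s≤s (s≤s (s≤s ())))
    miss : ∀ {w c} → A w c ≡ false → A w c ≡ true → ∀ {P : Set} → P
    miss off on = ⊥-elim (true≢false (trans (sym on) off))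
    only : ∀ i j → i < 3 → j < 3 → A (row i) (col j) ≡ true → CkOneℕ 3 i j
    only 0 0 _ _ _ = inj₁ refl
    only 0 1 _ _ _ = inj₂ (inj₁ refl)
    only 0 2 _ _ h = miss x₂ h
    only 1 0 _ _ h = miss y₀ h
    only 1 1 _ _ _ = inj₁ refl
    only 1 2 _ _ _ = inj₂ (inj₁ refl)
    only 2 0 _ _ _ = inj₂ (inj₂ (refl , refl))
    only 2 1 _ _ h = miss z₁ h
    only 2 2 _ _ _ = inj₁ refl
    only (suc (suc (suc _))) _ (s≤s (s≤s (s≤s ()))) _ _
    only _ (suc (suc (suc _))) _ (s≤s (s≤s (s≤s ()))) _
    diag : ∀ i → i < 3 → A (row i) (col i) ≡ true
    diag 0 _ = x₀
    diag 1 _ = y₁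
    diag 2 _ = z₂
    diag (suc (suc (suc _))) (s≤s (s≤s (s≤s ())))
    succ : ∀ i → suc i < 3 → A (row i) (col (suc i)) ≡ true
    succ 0 _ = x₁
    succ 1 _ = y₂
    succ (suc (suc _)) (s≤s (s≤s (s≤s ())))
    wrap : ∀ i → suc i ≡ 3 → A (row i) (col 0) ≡ true
    wrap 2 refl = z₀

CycAdj? : ∀ L (a b : Fin L) → Dec (CycAdj L a b)
CycAdj? L a b = (toℕ b ℕ.≟ suc (toℕ a)) ⊎-dec (toℕ a ℕ.≟ suc (toℕ b))
                ⊎-dec ((suc (toℕ a) ℕ.≟ L) ×-dec (toℕ b ℕ.≟ 0)) ⊎-dec ((suc (toℕ b) ℕ.≟ L) ×-dec (toℕ a ℕ.≟ 0))

-- Odd holes give odd cycle submatrices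

module CyclicOrder (ℓ₀ : ℕ) where
  ℓ : ℕ
  ℓ = suc ℓ₀

  _↝_ : Fin ℓ → Fin ℓ → Set
  i ↝ j = CycSucc ℓ (toℕ i) (toℕ j)

  next : Fin ℓ → Fin ℓ
  next t with suc (toℕ t) ℕ.<? ℓ
  ... | yes p = F.fromℕ< p
  ... | no _ = F.zero

  ↝-next : ∀ t → t ↝ next t
  ↝-next t with suc (toℕ t) ℕ.<? ℓ
  ... | yes p = inj₁ (FP.toℕ-fromℕ< p)
  ... | no np = inj₂ (≤-antisym (FP.toℕ<n t) (≮⇒≥ np) , refl)

  prev : Fin ℓ → Fin ℓ
  prev j with toℕ j ℕ.≟ 0
  ... | yes _ = F.fromℕ< (n<1+n ℓ₀)
  ... | no _ = F.fromℕ< (≤-<-trans (pred[n]≤n {toℕ j}) (FP.toℕ<n j))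

  prev-↝ : ∀ j → prev j ↝ j
  prev-↝ j with toℕ j ℕ.≟ 0
  ... | yes z = inj₂ (cong suc (FP.toℕ-fromℕ< (n<1+n ℓ₀)) , z)
  ... | no nz = inj₁ (trans (sucpred (toℕ j) nz) (cong suc (sym (FP.toℕ-fromℕ< (≤-<-trans (pred[n]≤n {toℕ j}) (FP.toℕ<n j))))))
    where
      sucpred : ∀ x → ¬ (x ≡ 0) → x ≡ suc (ℕ.pred x)
      sucpred zero nz = ⊥-elim (nz refl)
      sucpred (suc x) _ = refl

  ↝-functional : ∀ {i j j'} → i ↝ j → i ↝ j' → j ≡ j'
  ↝-functional {i} {j} {j'} (inj₁ p) (inj₁ q) = FP.toℕ-injective (trans p (sym q))
  ↝-functional {i} {j} {j'} (inj₁ p) (inj₂ (q , _)) = ⊥-elim (<-irrefl (trans p q) (FP.toℕ<n j))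
  ↝-functional {i} {j} {j'} (inj₂ (q , _)) (inj₁ p) = ⊥-elim (<-irrefl (trans p q) (FP.toℕ<n j'))
  ↝-functional {i} {j} {j'} (inj₂ (_ , p)) (inj₂ (_ , q)) = FP.toℕ-injective (trans p (sym q))

  ↝-injective : ∀ {i i' j} → i ↝ j → i' ↝ j → i ≡ i'
  ↝-injective (inj₁ p) (inj₁ q) = FP.toℕ-injective (suc-injective (trans (sym p) q))
  ↝-injective (inj₁ p) (inj₂ (_ , q)) with trans (sym p) q
  ... | ()
  ↝-injective (inj₂ (_ , q)) (inj₁ p) with trans (sym p) q
  ... | ()
  ↝-injective (inj₂ (p , _)) (inj₂ (q , _)) = FP.toℕ-injective (suc-injective (trans p (sym q)))

  ↝-irreflexive : 2 ≤ ℓ → ∀ {i} → i ↝ i → ⊥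
  ↝-irreflexive 2≤ℓ {i} (inj₁ p) = <-irrefl p (n<1+n (toℕ i))
  ↝-irreflexive 2≤ℓ {i} (inj₂ (q , z)) = <-irrefl (trans (cong suc (sym z)) q) 2≤ℓ

  CycAdj⇒↝ : ∀ a b → CycAdj ℓ a b → a ↝ b ⊎ b ↝ a
  CycAdj⇒↝ a b (inj₁ p) = inj₁ (inj₁ p)
  CycAdj⇒↝ a b (inj₂ (inj₁ p)) = inj₂ (inj₁ p)
  CycAdj⇒↝ a b (inj₂ (inj₂ (inj₁ p))) = inj₁ (inj₂ p)
  CycAdj⇒↝ a b (inj₂ (inj₂ (inj₂ p))) = inj₂ (inj₂ p)

  ↝⇒CycAdj : ∀ a b → a ↝ b → CycAdj ℓ a b
  ↝⇒CycAdj a b (inj₁ p) = inj₁ p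
  ↝⇒CycAdj a b (inj₂ p) = inj₂ (inj₂ (inj₁ p))

module Forward {m n : ℕ} (A : Matrix m n) where

  HasC⇒¬Balanced : ∀ ℓ₀ → 2 ≤ suc ℓ₀ → Odd (suc ℓ₀) → HasC A (suc ℓ₀) → ¬ Balanced A
  HasC⇒¬Balanced ℓ₀ 2≤ℓ odd (r , c , r-inj , c-inj , pat) bal =
    bal (suc ℓ₀ , odd , r , c , r-inj , c-inj , row-two , col-two)
    where
      open CyclicOrder ℓ₀
      row-two : ∀ i → ones (λ j → A (r i) (c j)) ≡ 2
      row-two i = trans (ones≡count (λ j → A (r i) (c j))) (count-two (λ j → A (r i) (c j)) i (next i)
        (λ i≡ → ↝-irreflexive 2≤ℓ (subst (i ↝_) (sym i≡) (↝-next i)))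
        (from (pat i i) (inj₁ refl)) (from (pat i (next i)) (inj₂ (↝-next i))) only)
        where
          only : ∀ x → A (r i) (c x) ≡ true → x ≡ i ⊎ x ≡ next i
          only x h with to (pat i x) h
          ... | inj₁ p = inj₁ (FP.toℕ-injective p)
          ... | inj₂ i↝x = inj₂ (↝-functional i↝x (↝-next i))
      col-two : ∀ j → ones (λ i → A (r i) (c j)) ≡ 2
      col-two j = trans (ones≡count (λ i → A (r i) (c j))) (count-two (λ i → A (r i) (c j)) j (prev j)
        (λ j≡ → ↝-irreflexive 2≤ℓ (subst (_↝ j) (sym j≡) (prev-↝ j)))
        (from (pat j j) (inj₁ refl)) (from (pat (prev j) j) (inj₂ (prev-↝ j))) only)
        where
          only : ∀ x → A (r x) (c j) ≡ true → x ≡ j ⊎ x ≡ prev j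
          only x h with to (pat x j) h
          ... | inj₁ p = inj₁ (FP.toℕ-injective (sym p))
          ... | inj₂ x↝j = inj₂ (↝-injective x↝j (prev-↝ j))

  module HoleRows (K : Subset m) (ℓ₀ : ℕ) (v : Fin (suc ℓ₀) → Fin n) (4≤ℓ : 4 ≤ suc ℓ₀) (v-inj : Injective _≡_ _≡_ v)
                  (adj : ∀ a b → ¬ (a ≡ b) → (IGrows A K (v a) (v b) ⇔ CycAdj (suc ℓ₀) a b)) where
    open CyclicOrder ℓ₀
    3≤ℓ : 3 ≤ suc ℓ₀
    3≤ℓ = ≤-trans (n≤1+n 3) 4≤ℓ

    2≤ℓ : 2 ≤ suc ℓ₀
    2≤ℓ = ≤-trans (n≤1+n 2) 3≤ℓ

    t≢next : ∀ t → ¬ (t ≡ next t)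
    t≢next t t≡ = ↝-irreflexive 2≤ℓ (subst (t ↝_) (sym t≡) (↝-next t))

    edge : ∀ t → IGrows A K (v t) (v (next t))
    edge t = from (adj t (next t) (t≢next t)) (↝⇒CycAdj t (next t) (↝-next t))

    row : Fin (suc ℓ₀) → Fin m
    row t = proj₁ (proj₂ (edge t))

    row∈K : ∀ t → row t ∈ K
    row∈K t = proj₁ (proj₂ (proj₂ (edge t)))

    row-here : ∀ t → A (row t) (v t) ≡ true
    row-here t = proj₁ (proj₂ (proj₂ (proj₂ (edge t))))

    row-next : ∀ t → A (row t) (v (next t)) ≡ true
    row-next t = proj₂ (proj₂ (proj₂ (proj₂ (edge t))))

    shared-row⇒↝ : ∀ t a b → ¬ (a ≡ b) → A (row t) (v a) ≡ true → A (row t) (v b) ≡ true → a ↝ b ⊎ b ↝ a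
    shared-row⇒↝ t a b a≢b ha hb = CycAdj⇒↝ a b (to (adj a b a≢b) ((λ e → a≢b (v-inj e)) , row t , row∈K t , ha , hb))

    row-only : ∀ t x → A (row t) (v x) ≡ true → x ≡ t ⊎ t ↝ x
    row-only t x hx with x F.≟ t
    ... | yes x≡t = inj₁ x≡t
    ... | no x≢t with shared-row⇒↝ t t x (λ e → x≢t (sym e)) (row-here t) hx
    ... | inj₁ t↝x = inj₂ t↝x
    ... | inj₂ x↝t with x F.≟ next t
    ... | yes x≡next = inj₂ (subst (t ↝_) (sym x≡next) (↝-next t))
    ... | no x≢next with shared-row⇒↝ t (next t) x (λ e → x≢next (sym e)) (row-next t) hx
    ... | inj₁ next↝x = ⊥-elim (CycSucc-no-triangle _ _ _ _ 4≤ℓ (↝-next t) next↝x x↝t)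
    ... | inj₂ x↝next = ⊥-elim (t≢next t (↝-functional x↝t x↝next))

    row-injective : Injective _≡_ _≡_ row
    row-injective {t} {t′} e with row-only t t′ (subst (λ w → A w (v t′) ≡ true) (sym e) (row-here t′))
    ... | inj₁ t′≡t = sym t′≡t
    ... | inj₂ t↝t′ with row-only t (next t′) (subst (λ w → A w (v (next t′)) ≡ true) (sym e) (row-next t′))
    ... | inj₁ next≡t = ⊥-elim (CycSucc-asym _ _ _ 3≤ℓ t↝t′ (subst (t′ ↝_) next≡t (↝-next t′)))
    ... | inj₂ t↝next = ⊥-elim (↝-irreflexive 2≤ℓ (subst (t′ ↝_) (sym (↝-functional t↝t′ t↝next)) (↝-next t′)))

    pat : ∀ i j → (A (row i) (v j) ≡ true) ⇔ CkOne (suc ℓ₀) i j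
    pat i j = mk⇔ only hit
      where
        only : A (row i) (v j) ≡ true → CkOne (suc ℓ₀) i j
        only h with row-only i j h
        ... | inj₁ j≡i = inj₁ (cong toℕ j≡i)
        ... | inj₂ i↝j = inj₂ i↝j
        hit : CkOne (suc ℓ₀) i j → A (row i) (v j) ≡ true
        hit (inj₁ p) = subst (λ z → A (row i) (v z) ≡ true) (FP.toℕ-injective (sym p)) (row-here i)
        hit (inj₂ i↝j) = subst (λ z → A (row i) (v z) ≡ true) (↝-functional (↝-next i) i↝j) (row-next i)

  hole⇒HasC : ∀ (K : Subset m) ℓ₀ (v : Fin (suc ℓ₀) → Fin n) → 4 ≤ suc ℓ₀ → Injective _≡_ _≡_ v →
              (∀ a b → ¬ (a ≡ b) → (IGrows A K (v a) (v b) ⇔ CycAdj (suc ℓ₀) a b)) → HasC A (suc ℓ₀)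
  hole⇒HasC K ℓ₀ v 4≤ℓ v-inj adj = row , v , row-injective , v-inj , pat
    where open HoleRows K ℓ₀ v 4≤ℓ v-inj adj

  Balanced⇒no-odd-hole : Balanced A → ∀ (K : Subset m) → ¬ HasOddHole (IGrows A K)
  Balanced⇒no-odd-hole bal K (zero , _ , v , () , _)
  Balanced⇒no-odd-hole bal K (suc ℓ₀ , oddℓ , v , l4 , vinj , adj) =
    HasC⇒¬Balanced ℓ₀ (≤-trans (≤-trans (n≤1+n 2) (n≤1+n 3)) l4) oddℓ (hole⇒HasC K ℓ₀ v l4 vinj adj) bal

-- Unbalanced matrices contain odd cycle submatrices

module Extraction {m n} (A : Matrix m n) (no-odd-C : ∀ L → 3 ≤ L → isOdd L ≡ true → HasC A L → ⊥)
                  {k : ℕ} (r : Fin k → Fin m) (c : Fin k → Fin n)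
                  (r-inj : Injective _≡_ _≡_ r) (c-inj : Injective _≡_ _≡_ c) where

  M : Fin k → Fin k → Bool
  M i j = A (r i) (c j)

  -- P and Q select the rows and columns of the k × k submatrix M that are still present.
  TwoPerRow TwoPerCol : (Fin k → Bool) → (Fin k → Bool) → Set
  TwoPerRow P Q = ∀ i → P i ≡ true → count (λ j → Q j ∧ M i j) ≡ 2
  TwoPerCol P Q = ∀ j → Q j ≡ true → count (λ i → P i ∧ M i j) ≡ 2

  OddTwoRegular : (Fin k → Bool) → (Fin k → Bool) → Set
  OddTwoRegular P Q = TwoPerRow P Q × TwoPerCol P Q × isOdd (count Q) ≡ true

  OddCycleOrSmaller : (Fin k → Bool) → Set
  OddCycleOrSmaller Q = (Σ ℕ λ T → 3 ≤ T × isOdd T ≡ true × HasC A T)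
                      ⊎ (Σ (Fin k → Bool) λ P′ → Σ (Fin k → Bool) λ Q′ → count Q′ < count Q × OddTwoRegular P′ Q′)

  -- Alternately leave the current row and the current column through its other 1; the first
  -- repeated column closes a cycle, and an even one can be deleted keeping the system 2-regular and odd.
  module Walk (P Q : Fin k → Bool) (two-per-row : TwoPerRow P Q) (two-per-col : TwoPerCol P Q) where

    record Pos : Set where
      constructor pos
      field
        col : Fin k
        row : Fin k
        col∈Q : Q col ≡ true
        row∈P : P row ≡ true
        hit : M row col ≡ true
    open Pos

    -- Opaque because unfolding these choices during type checking is prohibitively expensive.
    opaque
      other-col : (p : Pos) → ∃ λ j → ¬ (j ≡ col p) × (Q j ∧ M (row p) j) ≡ true
      other-col p = count≡2⇒another _ (col p) (two-per-row (row p) (row∈P p)) (∧-intro (col∈Q p) (hit p))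

      other-row : (p : Pos) → ∃ λ i → ¬ (i ≡ row p) × (P i ∧ M i (proj₁ (other-col p))) ≡ true
      other-row p = count≡2⇒another _ (row p) (two-per-col (proj₁ (other-col p)) (∧-conicalˡ _ _ qm)) (∧-intro (row∈P p) (∧-conicalʳ _ _ qm))
        where
          qm : (Q (proj₁ (other-col p)) ∧ M (row p) (proj₁ (other-col p))) ≡ true
          qm = proj₂ (proj₂ (other-col p))

    step : Pos → Pos
    step p = pos (proj₁ (other-col p)) (proj₁ (other-row p))
                 (∧-conicalˡ _ _ (proj₂ (proj₂ (other-col p))))
                 (∧-conicalˡ _ _ (proj₂ (proj₂ (other-row p)))) (∧-conicalʳ _ _ (proj₂ (proj₂ (other-row p))))

    module _ (start : Pos) where

      walk : ℕ → Pos
      walk zero = start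
      walk (suc t) = step (walk t)

      v e : ℕ → Fin k
      v t = col (walk t)
      e t = row (walk t)

      e-hits-next : ∀ t → M (e t) (v (suc t)) ≡ true
      e-hits-next t = ∧-conicalʳ _ _ (proj₂ (proj₂ (other-col (walk t))))

      v-moves : ∀ t → ¬ (v (suc t) ≡ v t)
      v-moves t = proj₁ (proj₂ (other-col (walk t)))

      e-moves : ∀ t → ¬ (e (suc t) ≡ e t)
      e-moves t = proj₁ (proj₂ (other-row (walk t)))

      row-exact : ∀ t x → Q x ≡ true → M (e t) x ≡ true → x ≡ v t ⊎ x ≡ v (suc t)
      row-exact t x qx mx =
        count≡2⇒one-of (λ j → Q j ∧ M (e t) j) (v t) (v (suc t)) x (two-per-row (e t) (row∈P (walk t)))
          (∧-intro (col∈Q (walk t)) (hit (walk t))) (∧-intro (col∈Q (walk (suc t))) (e-hits-next t))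
          (λ q → v-moves t (sym q)) (∧-intro qx mx)

      col-exact : ∀ t i → P i ≡ true → M i (v (suc t)) ≡ true → i ≡ e t ⊎ i ≡ e (suc t)
      col-exact t i pi mi =
        count≡2⇒one-of (λ i′ → P i′ ∧ M i′ (v (suc t))) (e t) (e (suc t)) i (two-per-col (v (suc t)) (col∈Q (walk (suc t))))
          (∧-intro (row∈P (walk t)) (e-hits-next t)) (∧-intro (row∈P (walk (suc t))) (hit (walk (suc t))))
          (λ q → e-moves t (sym q)) (∧-intro pi mi)

      seen-before : ℕ → Bool
      seen-before T = anyBelow T (λ s → v s == v T)

      some-column-repeats : Σ ℕ λ T → seen-before T ≡ true
      some-column-repeats with FP.pigeonhole (n<1+n k) (λ t → v (toℕ t))
      ... | a , b , a<b , va≡vb = toℕ b , anyBelow⁺ (toℕ b) _ (toℕ a) a<b (subst (λ z → (v (toℕ a) == z) ≡ true) va≡vb (==-refl _))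

      module FirstRepeat (T s : ℕ) (s<T : s < T) (vs≡vT : v s ≡ v T)
                         (first : ∀ T′ → T′ < T → seen-before T′ ≡ false) where

        v-distinct : ∀ x y → x < y → y < T → ¬ (v x ≡ v y)
        v-distinct x y x<y y<T vx≡vy =
          true≢false (trans (sym (anyBelow⁺ y _ x x<y (subst (λ z → (v x == z) ≡ true) vx≡vy (==-refl _)))) (first y y<T))

        v-injective : ∀ x y → x < T → y < T → v x ≡ v y → x ≡ y
        v-injective x y x<T y<T vx≡vy with <-cmp x y
        ... | tri< x<y _ _ = ⊥-elim (v-distinct x y x<y y<T vx≡vy)
        ... | tri≈ _ x≡y _ = x≡y
        ... | tri> _ _ y<x = ⊥-elim (v-distinct y x y<x x<T (sym vx≡vy))

        e-distinct : ∀ a b → a < b → b < T → ¬ (e a ≡ e b)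
        e-distinct a b a<b b<T ea≡eb with row-exact a (v b) (col∈Q (walk b)) (subst (λ i → M i (v b) ≡ true) (sym ea≡eb) (hit (walk b)))
        ... | inj₁ vb≡va = v-distinct a b a<b b<T (sym vb≡va)
        ... | inj₂ vb≡va′ with m≤n⇒m<n∨m≡n a<b
        ... | inj₁ 1+a<b = v-distinct (suc a) b 1+a<b b<T (sym vb≡va′)
        ... | inj₂ refl = e-moves a (sym ea≡eb)

        T₀ : ℕ
        T₀ = ℕ.pred T

        T≡1+T₀ : T ≡ suc T₀
        T≡1+T₀ = sym (suc-pred T ⦃ ℕ.>-nonZero (≤-<-trans z≤n s<T) ⦄)

        T₀<T : T₀ < T
        T₀<T = subst (T₀ <_) (sym T≡1+T₀) (n<1+n T₀)

        repeat-at-start : s ≡ 0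
        repeat-at-start = go s s<T vs≡vT
          where
            go : ∀ s → s < T → v s ≡ v T → s ≡ 0
            go zero _ _ = refl
            go (suc s′) 1+s′<T vs≡vT = ⊥-elim (cases (col-exact s′ (e T₀) (row∈P (walk T₀)) hits))
              where
                hits : M (e T₀) (v (suc s′)) ≡ true
                hits = subst (λ z → M (e T₀) z ≡ true) (sym (trans vs≡vT (cong v T≡1+T₀))) (e-hits-next T₀)
                1+s′≤T₀ : suc s′ ≤ T₀
                1+s′≤T₀ = ≤-pred (subst (suc s′ <_) T≡1+T₀ 1+s′<T)
                cases : e T₀ ≡ e s′ ⊎ e T₀ ≡ e (suc s′) → ⊥
                cases (inj₁ q) = e-distinct s′ T₀ 1+s′≤T₀ T₀<T (sym q)
                cases (inj₂ q) with m≤n⇒m<n∨m≡n 1+s′≤T₀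
                ... | inj₁ 1+s′<T₀ = e-distinct (suc s′) T₀ 1+s′<T₀ T₀<T (sym q)
                ... | inj₂ 1+s′≡T₀ = v-moves (suc s′)
                      (trans (cong (λ z → v (suc z)) 1+s′≡T₀) (trans (cong v (sym T≡1+T₀)) (sym vs≡vT)))

        v0≡vT : v 0 ≡ v T
        v0≡vT = subst (λ z → v z ≡ v T) repeat-at-start vs≡vT

        2≤T : 2 ≤ T
        2≤T = go T (≤-<-trans z≤n s<T) v0≡vT
          where
            go : ∀ T → 0 < T → v 0 ≡ v T → 2 ≤ T
            go (suc zero) _ v0≡v1 = ⊥-elim (v-moves 0 (sym v0≡v1))
            go (suc (suc _)) _ _ = s≤s (s≤s z≤n)

        cycle : HasC A T
        cycle = HasC-fromℕ A T (λ t → r (e t)) (λ x → c (v x))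
                  (λ a b a<b b<T eq → e-distinct a b a<b b<T (r-inj eq))
                  (λ x y x<y y<T eq → v-distinct x y x<y y<T (c-inj eq))
                  only (λ t _ → hit (walk t)) (λ t _ → e-hits-next t)
                  (λ t 1+t≡T → subst (λ z → M (e t) z ≡ true) (trans (cong v 1+t≡T) (sym v0≡vT)) (e-hits-next t))
          where
            only : ∀ t x → t < T → x < T → M (e t) (v x) ≡ true → CkOneℕ T t x
            only t x t<T x<T h with row-exact t (v x) (col∈Q (walk x)) h
            ... | inj₁ vx≡vt = inj₁ (v-injective x t x<T t<T vx≡vt)
            ... | inj₂ vx≡vt′ with m≤n⇒m<n∨m≡n t<T
            ... | inj₁ 1+t<T = inj₂ (inj₁ (v-injective x (suc t) x<T 1+t<T vx≡vt′))
            ... | inj₂ 1+t≡T = inj₂ (inj₂ (1+t≡T , v-injective x 0 x<T (<-≤-trans (s≤s z≤n) 2≤T)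
                                                   (trans vx≡vt′ (trans (cong v 1+t≡T) (sym v0≡vT)))))

        visited-col visited-row : Fin k → Bool
        visited-col j = anyBelow T (λ x → v x == j)
        visited-row i = anyBelow T (λ t → e t == i)

        P′ Q′ : Fin k → Bool
        P′ i = P i ∧ not (visited-row i)
        Q′ j = Q j ∧ not (visited-col j)

        visited-col⇒Q : ∀ j → (Q j ∧ visited-col j) ≡ visited-col j
        visited-col⇒Q j with visited-col j in vis
        ... | false = ∧-zeroʳ (Q j)
        ... | true with anyBelow⁻ T _ vis
        ... | x , _ , vx==j = cong (_∧ true) (trans (cong Q (sym (==⇒≡ _ _ vx==j))) (col∈Q (walk x)))

        count-Q : count Q ≡ count Q′ + T
        count-Q = trans (count-split Q visited-col)
                        (cong (count Q′ +_) (trans (count-cong _ _ visited-col⇒Q) (count-image v T v-distinct)))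

        visited-row⁺ : ∀ i x → x < T → P i ≡ true → M i (v x) ≡ true → visited-row i ≡ true
        visited-row⁺ i zero 0<T pi mi with
          count≡2⇒one-of (λ i′ → P i′ ∧ M i′ (v 0)) (e 0) (e T₀) i (two-per-col (v 0) (col∈Q (walk 0)))
            (∧-intro (row∈P (walk 0)) (hit (walk 0)))
            (∧-intro (row∈P (walk T₀)) (subst (λ z → M (e T₀) z ≡ true) (trans (cong v (sym T≡1+T₀)) (sym v0≡vT)) (e-hits-next T₀)))
            (e-distinct 0 T₀ (<-≤-trans (s≤s z≤n) (≤-pred (subst (2 ≤_) T≡1+T₀ 2≤T))) T₀<T)
            (∧-intro pi mi)
        ... | inj₁ i≡e0 = anyBelow⁺ T _ 0 0<T (subst (λ z → (e 0 == z) ≡ true) (sym i≡e0) (==-refl _))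
        ... | inj₂ i≡eT₀ = anyBelow⁺ T _ T₀ T₀<T (subst (λ z → (e T₀ == z) ≡ true) (sym i≡eT₀) (==-refl _))
        visited-row⁺ i (suc x) 1+x<T pi mi with col-exact x i pi mi
        ... | inj₁ i≡ex = anyBelow⁺ T _ x (<-trans (n<1+n x) 1+x<T) (subst (λ z → (e x == z) ≡ true) (sym i≡ex) (==-refl _))
        ... | inj₂ i≡e1+x = anyBelow⁺ T _ (suc x) 1+x<T (subst (λ z → (e (suc x) == z) ≡ true) (sym i≡e1+x) (==-refl _))

        visited-col⁺ : ∀ j t → t < T → M (e t) j ≡ true → Q j ≡ true → visited-col j ≡ true
        visited-col⁺ j t t<T mj qj with row-exact t j qj mj
        ... | inj₁ j≡vt = anyBelow⁺ T _ t t<T (subst (λ z → (v t == z) ≡ true) (sym j≡vt) (==-refl _))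
        ... | inj₂ j≡v1+t with m≤n⇒m<n∨m≡n t<T
        ... | inj₁ 1+t<T = anyBelow⁺ T _ (suc t) 1+t<T (subst (λ z → (v (suc t) == z) ≡ true) (sym j≡v1+t) (==-refl _))
        ... | inj₂ 1+t≡T = anyBelow⁺ T _ 0 (<-≤-trans (s≤s z≤n) 2≤T)
                             (subst (λ z → (v 0 == z) ≡ true) (trans v0≡vT (trans (cong v (sym 1+t≡T)) (sym j≡v1+t))) (==-refl _))

        two-per-row′ : TwoPerRow P′ Q′
        two-per-row′ i pi′ = trans (count-cong _ _ same) (two-per-row i (∧-conicalˡ _ _ pi′))
          where
            same : ∀ j → (Q′ j ∧ M i j) ≡ (Q j ∧ M i j)
            same j = ∧-not-irrelevant (Q j) (M i j) (visited-col j) λ qm → ¬-not λ vis →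
              let (x , x<T , vx==j) = anyBelow⁻ T _ vis in
              true≢false (trans (sym (visited-row⁺ i x x<T (∧-conicalˡ _ _ pi′)
                                        (subst (λ z → M i z ≡ true) (sym (==⇒≡ _ _ vx==j)) (∧-conicalʳ _ _ qm))))
                                (not≡true⇒≡false (∧-conicalʳ _ _ pi′)))

        two-per-col′ : TwoPerCol P′ Q′
        two-per-col′ j qj′ = trans (count-cong _ _ same) (two-per-col j (∧-conicalˡ _ _ qj′))
          where
            same : ∀ i → (P′ i ∧ M i j) ≡ (P i ∧ M i j)
            same i = ∧-not-irrelevant (P i) (M i j) (visited-row i) λ pm → ¬-not λ vis →
              let (t , t<T , et==i) = anyBelow⁻ T _ vis in
              true≢false (trans (sym (visited-col⁺ j t t<T (subst (λ z → M z j ≡ true) (sym (==⇒≡ _ _ et==i)) (∧-conicalʳ _ _ pm))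
                                        (∧-conicalˡ _ _ qj′)))
                                (not≡true⇒≡false (∧-conicalʳ _ _ qj′)))

        odd-cycle-or-smaller : isOdd (count Q) ≡ true → OddCycleOrSmaller Q
        odd-cycle-or-smaller Q-odd with isOdd T in T-parity
        ... | true = inj₁ (T , odd-2≤⇒3≤ T 2≤T T-parity , T-parity , cycle)
        ... | false = inj₂ (P′ , Q′ , Q′-smaller , two-per-row′ , two-per-col′ , Q′-odd)
          where
            Q′-smaller : count Q′ < count Q
            Q′-smaller = subst (count Q′ <_) (sym count-Q) (m<m+n (count Q′) (<-≤-trans (s≤s z≤n) 2≤T))
            Q′-odd : isOdd (count Q′) ≡ true
            Q′-odd = begin
              isOdd (count Q′)                 ≡⟨ xor-identityʳ _ ⟨
              isOdd (count Q′) xor false       ≡⟨ cong (isOdd (count Q′) xor_) T-parity ⟨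
              isOdd (count Q′) xor isOdd T     ≡⟨ isOdd-+ (count Q′) T ⟨
              isOdd (count Q′ + T)             ≡⟨ cong isOdd count-Q ⟨
              isOdd (count Q)                  ≡⟨ Q-odd ⟩
              true                             ∎
              where
                open ≡-Reasoning

      closed-walk : isOdd (count Q) ≡ true → OddCycleOrSmaller Q
      closed-walk with least-witness seen-before (proj₁ some-column-repeats) (proj₂ some-column-repeats)
      ... | T , _ , seen , first with anyBelow⁻ T _ seen
      ... | s , s<T , vs==vT = FirstRepeat.odd-cycle-or-smaller T s s<T (==⇒≡ _ _ vs==vT) first

  odd-cycle-or-smaller : ∀ P Q → OddTwoRegular P Q → OddCycleOrSmaller Q
  odd-cycle-or-smaller P Q (two-per-row , two-per-col , Q-odd)
    with count>0⇒∃ Q (n≢0⇒n>0 (λ c≡0 → true≢false (trans (sym Q-odd) (cong isOdd c≡0))))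
  ... | j₀ , qj₀ with count>0⇒∃ (λ i → P i ∧ M i j₀) (subst (0 <_) (sym (two-per-col j₀ qj₀)) (s≤s z≤n))
  ... | i₀ , pm = Walk.closed-walk P Q two-per-row two-per-col (Walk.pos j₀ i₀ qj₀ (∧-conicalˡ _ _ pm) (∧-conicalʳ _ _ pm)) Q-odd

  no-odd-two-regular : ∀ P Q → OddTwoRegular P Q → ⊥
  no-odd-two-regular P Q = <-rec (λ c → ∀ P Q → count Q ≡ c → OddTwoRegular P Q → ⊥) step (count Q) P Q refl
    where
      step : ∀ c → (∀ {c′} → c′ < c → ∀ P Q → count Q ≡ c′ → OddTwoRegular P Q → ⊥) →
             ∀ P Q → count Q ≡ c → OddTwoRegular P Q → ⊥
      step _ smaller P Q refl regular with odd-cycle-or-smaller P Q regular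
      ... | inj₁ (T , 3≤T , T-odd , C) = no-odd-C T 3≤T T-odd C
      ... | inj₂ (P′ , Q′ , Q′<Q , regular′) = smaller Q′<Q P′ Q′ refl regular′

no-odd-C⇒Balanced : ∀ {m n} (A : Matrix m n) → (∀ L → 3 ≤ L → isOdd L ≡ true → HasC A L → ⊥) → Balanced A
no-odd-C⇒Balanced A no-odd-C (k , k-odd , r , c , r-inj , c-inj , rows , cols) =
  no-odd-two-regular (λ _ → true) (λ _ → true)
    ( (λ i _ → trans (sym (ones≡count (λ j → A (r i) (c j)))) (rows i))
    , (λ j _ → trans (sym (ones≡count (λ i → A (r i) (c j)))) (cols j))
    , subst (λ z → isOdd z ≡ true) (sym (count-all k)) (Odd⇒isOdd k-odd))
  where
    open Extraction A no-odd-C r c r-inj c-inj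

-- Cycles as periodic sequences

module Modulo (L₀ : ℕ) where

  L : ℕ
  L = suc L₀

  _≈_ : ℕ → ℕ → Set
  a ≈ b = a % L ≡ b % L

  ≈-+ : ∀ {a b} x → a ≈ b → (a + x) ≈ (b + x)
  ≈-+ {a} {b} x a≈b = trans (%-distribˡ-+ a x L) (trans (cong (λ z → (z + x % L) % L) a≈b) (sym (%-distribˡ-+ b x L)))

  ≈-suc : ∀ {a b} → a ≈ b → suc a ≈ suc b
  ≈-suc {a} {b} a≈b = subst₂ _≈_ (+-comm a 1) (+-comm b 1) (≈-+ {a} {b} 1 a≈b)

  +L≈ : ∀ a → (a + L) ≈ a
  +L≈ a = [m+n]%n≡m%n a L

  suc-% : ∀ i → suc i % L ≡ suc (i % L) % L
  suc-% i = trans (cong (λ z → suc z % L) (m≡m%n+[m/n]*n i L)) ([m+kn]%n≡m%n (suc (i % L)) (i / L) L)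

  suc-%-cases : ∀ i → (suc (i % L) < L × suc i % L ≡ suc (i % L)) ⊎ (suc (i % L) ≡ L × suc i % L ≡ 0)
  suc-%-cases i with m≤n⇒m<n∨m≡n (m%n<n i L)
  ... | inj₁ 1+i%L<L = inj₁ (1+i%L<L , trans (suc-% i) (m<n⇒m%n≡m 1+i%L<L))
  ... | inj₂ 1+i%L≡L = inj₂ (1+i%L≡L , trans (suc-% i) (trans (cong (_% L) 1+i%L≡L) (n%n≡0 L)))

  ≈⇒quotients : ∀ i d → (i + d) ≈ i → i / L * L + d ≡ (i + d) / L * L
  ≈⇒quotients i d eq = +-cancelˡ-≡ (i % L) _ _ (begin
    i % L + (i / L * L + d)         ≡⟨ +-assoc (i % L) (i / L * L) d ⟨
    i % L + i / L * L + d           ≡⟨ cong (_+ d) (m≡m%n+[m/n]*n i L) ⟨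
    i + d                           ≡⟨ m≡m%n+[m/n]*n (i + d) L ⟩
    (i + d) % L + (i + d) / L * L   ≡⟨ cong (_+ (i + d) / L * L) eq ⟩
    i % L + (i + d) / L * L         ∎)
    where
      open ≡-Reasoning

  shift-≉ : ∀ i d → 0 < d → d < L → ¬ ((i + d) ≈ i)
  shift-≉ i d 0<d d<L eq with (i + d) / L ℕ.≤? i / L
  ... | yes q′≤q = <-irrefl refl (≤-trans 0<d (+-cancelˡ-≤ (i / L * L) d 0
          (subst (i / L * L + d ≤_) (sym (+-identityʳ (i / L * L)))
                 (≤-trans (≤-reflexive (≈⇒quotients i d eq)) (*-monoˡ-≤ L q′≤q)))))
  ... | no q′≰q = <-irrefl refl (<-≤-trans d<L (+-cancelˡ-≤ (i / L * L) L d
          (subst (_≤ i / L * L + d) (+-comm L (i / L * L))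
                 (≤-trans (*-monoˡ-≤ L (≰⇒> q′≰q)) (≤-reflexive (sym (≈⇒quotients i d eq)))))))

  window-rep : ∀ a i → ∃ λ e → a < e × e ≤ a + L × e ≈ i
  window-rep zero i with i % L ℕ.≟ 0
  ... | yes i%L≡0 = L , s≤s z≤n , ≤-refl , trans (n%n≡0 L) (sym i%L≡0)
  ... | no i%L≢0 = i % L , n≢0⇒n>0 i%L≢0 , <⇒≤ (m%n<n i L) , m%n%n≡m%n i L
  window-rep (suc a) i with window-rep a i
  ... | e , a<e , e≤a+L , e≈i with m≤n⇒m<n∨m≡n a<e
  ... | inj₁ 1+a<e = e , 1+a<e , m≤n⇒m≤1+n e≤a+L , e≈i
  ... | inj₂ 1+a≡e = e + L , subst (_< e + L) (sym 1+a≡e) (m<m+n e (s≤s z≤n)) ,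
                     ≤-reflexive (cong (_+ L) (sym 1+a≡e)) , trans (+L≈ e) e≈i

module Periodic {X : Set} (L₀ : ℕ) (f : ℕ → X) (periodic : ∀ i → f (i + suc L₀) ≡ f i) where
  open Modulo L₀

  f-% : ∀ y → f y ≡ f (y % L)
  f-% y = trans (cong f (m≡m%n+[m/n]*n y L)) (multiples (y / L) (y % L))
    where
      multiples : ∀ q y → f (y + q * L) ≡ f y
      multiples zero y = cong f (+-identityʳ y)
      multiples (suc q) y = trans (cong f (trans (cong (y +_) (+-comm L (q * L))) (sym (+-assoc y (q * L) L))))
                                  (trans (periodic (y + q * L)) (multiples q y))

  ≈⇒≡ : ∀ {a b} → a ≈ b → f a ≡ f b
  ≈⇒≡ {a} {b} a≈b = trans (f-% a) (trans (cong f a≈b) (sym (f-% b)))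

  module _ (distinct : ∀ i d → 0 < d → d < L → ¬ (f (i + d) ≡ f i)) where

    ordered-window-injective : ∀ i j → i ≤ j → j < i + L → f i ≡ f j → i ≡ j
    ordered-window-injective i j i≤j j<i+L fi≡fj with m≤n⇒m<n∨m≡n i≤j
    ... | inj₂ i≡j = i≡j
    ... | inj₁ i<j = ⊥-elim (distinct i (j ∸ i) (m<n⇒0<n∸m i<j)
                       (+-cancelʳ-< i (j ∸ i) L (subst (_< L + i) (sym (m∸n+n≡m i≤j)) (subst (j <_) (+-comm i L) j<i+L)))
                       (trans (cong f (m+[n∸m]≡n i≤j)) (sym fi≡fj)))

    window-injective : ∀ w a b → w ≤ a → a < w + L → w ≤ b → b < w + L → f a ≡ f b → a ≡ b
    window-injective w a b w≤a a<w+L w≤b b<w+L fa≡fb with ≤-total a b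
    ... | inj₁ a≤b = ordered-window-injective a b a≤b (<-≤-trans b<w+L (+-monoˡ-≤ L w≤a)) fa≡fb
    ... | inj₂ b≤a = sym (ordered-window-injective b a b≤a (<-≤-trans a<w+L (+-monoˡ-≤ L w≤b)) (sym fa≡fb))

    ≡⇒≈ : ∀ {a b} → f a ≡ f b → a ≈ b
    ≡⇒≈ {a} {b} fa≡fb = window-injective 0 (a % L) (b % L) z≤n (m%n<n a L) z≤n (m%n<n b L)
                          (trans (sym (f-% a)) (trans fa≡fb (f-% b)))

module Cycles {m n : ℕ} (A : Matrix m n) where

  -- A C_L unrolled into L-periodic sequences over ℕ, so that arcs of the cycle are plain intervals.
  record PeriodicCycle (L : ℕ) : Set where
    field
      col : ℕ → Fin n
      row : ℕ → Fin m
      col-periodic : ∀ i → col (i + L) ≡ col i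
      row-periodic : ∀ i → row (i + L) ≡ row i
      col-distinct : ∀ i d → 0 < d → d < L → ¬ (col (i + d) ≡ col i)
      row-distinct : ∀ i d → 0 < d → d < L → ¬ (row (i + d) ≡ row i)
      row-hits-col : ∀ i → A (row i) (col i) ≡ true
      row-hits-next : ∀ i → A (row i) (col (suc i)) ≡ true
      row-only : ∀ i j → A (row i) (col j) ≡ true → col j ≡ col i ⊎ col j ≡ col (suc i)

  HasC⇒PeriodicCycle : ∀ L₀ → HasC A (suc L₀) → PeriodicCycle (suc L₀)
  HasC⇒PeriodicCycle L₀ (r , c , r-inj , c-inj , pat) = record
    { col = λ i → c (idx i)
    ; row = λ i → r (idx i)
    ; col-periodic = λ i → cong c (idx-periodic i)
    ; row-periodic = λ i → cong r (idx-periodic i)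
    ; col-distinct = λ i d 0<d d<L eq → shift-≉ i d 0<d d<L (trans (sym (toℕ-idx (i + d))) (trans (cong toℕ (c-inj eq)) (toℕ-idx i)))
    ; row-distinct = λ i d 0<d d<L eq → shift-≉ i d 0<d d<L (trans (sym (toℕ-idx (i + d))) (trans (cong toℕ (r-inj eq)) (toℕ-idx i)))
    ; row-hits-col = λ i → from (pat (idx i) (idx i)) (inj₁ refl)
    ; row-hits-next = λ i → from (pat (idx i) (idx (suc i))) (idx-succ i)
    ; row-only = λ i j h → idx-only i j (to (pat (idx i) (idx j)) h)
    }
    where
      open Modulo L₀
      idx : ℕ → Fin L
      idx i = F.fromℕ< (m%n<n i L)
      toℕ-idx : ∀ i → toℕ (idx i) ≡ i % L
      toℕ-idx i = FP.toℕ-fromℕ< (m%n<n i L)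
      idx-periodic : ∀ i → idx (i + L) ≡ idx i
      idx-periodic i = FP.toℕ-injective (trans (toℕ-idx (i + L)) (trans (+L≈ i) (sym (toℕ-idx i))))
      idx-succ : ∀ i → CkOne L (idx i) (idx (suc i))
      idx-succ i with suc-%-cases i
      ... | inj₁ (_ , e) = inj₂ (inj₁ (trans (toℕ-idx (suc i)) (trans e (cong suc (sym (toℕ-idx i))))))
      ... | inj₂ (e₁ , e₂) = inj₂ (inj₂ (trans (cong suc (toℕ-idx i)) e₁ , trans (toℕ-idx (suc i)) e₂))
      idx-only : ∀ i j → CkOne L (idx i) (idx j) → c (idx j) ≡ c (idx i) ⊎ c (idx j) ≡ c (idx (suc i))
      idx-only i j (inj₁ e) = inj₁ (cong c (FP.toℕ-injective e))
      idx-only i j (inj₂ (inj₁ e)) with suc-%-cases i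
      ... | inj₁ (_ , e′) = inj₂ (cong c (FP.toℕ-injective (trans e (trans (cong suc (toℕ-idx i)) (trans (sym e′) (sym (toℕ-idx (suc i))))))))
      ... | inj₂ (e₁ , _) = ⊥-elim (<-irrefl refl (subst (_< L) (trans e (trans (cong suc (toℕ-idx i)) e₁)) (FP.toℕ<n (idx j))))
      idx-only i j (inj₂ (inj₂ (e₁ , e₂))) with suc-%-cases i
      ... | inj₁ (lt , _) = ⊥-elim (<-irrefl (trans (cong suc (sym (toℕ-idx i))) e₁) lt)
      ... | inj₂ (_ , e′) = inj₂ (cong c (FP.toℕ-injective (trans e₂ (trans (sym e′) (sym (toℕ-idx (suc i)))))))

  module PeriodicCycleLemmas (L₀ : ℕ) (cycle : PeriodicCycle (suc L₀)) where
    open PeriodicCycle cycle public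
    open Modulo L₀ public

    ≈⇒col≡ : ∀ {a b} → a ≈ b → col a ≡ col b
    ≈⇒col≡ = Periodic.≈⇒≡ L₀ col col-periodic

    ≈⇒row≡ : ∀ {a b} → a ≈ b → row a ≡ row b
    ≈⇒row≡ = Periodic.≈⇒≡ L₀ row row-periodic

    col≡⇒≈ : ∀ {a b} → col a ≡ col b → a ≈ b
    col≡⇒≈ = Periodic.≡⇒≈ L₀ col col-periodic col-distinct

    col-window-injective : ∀ w a b → w ≤ a → a < w + L → w ≤ b → b < w + L → col a ≡ col b → a ≡ b
    col-window-injective = Periodic.window-injective L₀ col col-periodic col-distinct

    row-window-injective : ∀ w a b → w ≤ a → a < w + L → w ≤ b → b < w + L → row a ≡ row b → a ≡ b
    row-window-injective = Periodic.window-injective L₀ row row-periodic row-distinct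

    OnCycle : Fin m → Set
    OnCycle z = ∃ λ i → row i ≡ z

    module SubCycle (L′ w : ℕ) (σ : ℕ → ℕ) (R : ℕ → Fin m) where

      Traverses : ℕ → ℕ → Set
      Traverses i p = (σ i ≡ p × σ (cyc-next L′ i) ≡ suc p) ⊎ (σ i ≡ suc p × σ (cyc-next L′ i) ≡ p)

      CycleRowSpec : ℕ → Set
      CycleRowSpec i = Σ ℕ λ p → R i ≡ row p × w ≤ p × suc p < w + L × Traverses i p

      ChordRowSpec : ℕ → Set
      ChordRowSpec i = ¬ OnCycle (R i) × (∀ j → j < L′ → A (R i) (col (σ j)) ≡ true → j ≡ i ⊎ j ≡ cyc-next L′ i)
                       × A (R i) (col (σ i)) ≡ true × A (R i) (col (σ (cyc-next L′ i))) ≡ true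

      module _ (3≤L′ : 3 ≤ L′) (σ-window : ∀ i → i < L′ → w ≤ σ i × σ i < w + L)
               (σ-distinct : ∀ i j → i < j → j < L′ → ¬ (σ i ≡ σ j))
               (spec : ∀ i → i < L′ → CycleRowSpec i ⊎ ChordRowSpec i) where

        σ-injective : ∀ a b → a < L′ → b < L′ → σ a ≡ σ b → a ≡ b
        σ-injective a b a<L′ b<L′ e with <-cmp a b
        ... | tri< a<b _ _ = ⊥-elim (σ-distinct a b a<b b<L′ e)
        ... | tri≈ _ a≡b _ = a≡b
        ... | tri> _ _ b<a = ⊥-elim (σ-distinct b a b<a a<L′ (sym e))

        col-σ-injective : ∀ a b → a < L′ → b < L′ → col (σ a) ≡ col (σ b) → a ≡ b
        col-σ-injective a b a<L′ b<L′ e = σ-injective a b a<L′ b<L′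
          (col-window-injective w _ _ (proj₁ (σ-window a a<L′)) (proj₂ (σ-window a a<L′))
                                      (proj₁ (σ-window b b<L′)) (proj₂ (σ-window b b<L′)) e)

        R-hits-both : ∀ i → i < L′ → A (R i) (col (σ i)) ≡ true × A (R i) (col (σ (cyc-next L′ i))) ≡ true
        R-hits-both i i<L′ with spec i i<L′
        ... | inj₂ (_ , _ , h₁ , h₂) = h₁ , h₂
        ... | inj₁ (p , Ri≡ , _ , _ , inj₁ (e₁ , e₂)) rewrite Ri≡ | e₁ | e₂ = row-hits-col p , row-hits-next p
        ... | inj₁ (p , Ri≡ , _ , _ , inj₂ (e₁ , e₂)) rewrite Ri≡ | e₁ | e₂ = row-hits-next p , row-hits-col p

        R-only : ∀ i j → i < L′ → j < L′ → A (R i) (col (σ j)) ≡ true → j ≡ i ⊎ j ≡ cyc-next L′ i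
        R-only i j i<L′ j<L′ h with spec i i<L′
        ... | inj₂ (_ , only , _) = only j j<L′ h
        ... | inj₁ (p , Ri≡ , w≤p , 1+p<w+L , trav) = on-cycle (row-only p (σ j) (subst (λ z → A z (col (σ j)) ≡ true) Ri≡ h)) trav
          where
            σj : w ≤ σ j × σ j < w + L
            σj = σ-window j j<L′
            at : ∀ {q} → w ≤ q → q < w + L → col (σ j) ≡ col q → σ j ≡ q
            at w≤q q<w+L = col-window-injective w _ _ (proj₁ σj) (proj₂ σj) w≤q q<w+L
            on-cycle : col (σ j) ≡ col p ⊎ col (σ j) ≡ col (suc p) → Traverses i p → j ≡ i ⊎ j ≡ cyc-next L′ i
            on-cycle (inj₁ c) (inj₁ (e₁ , e₂)) = inj₁ (σ-injective j i j<L′ i<L′ (trans (at w≤p (<-trans (n<1+n p) 1+p<w+L) c) (sym e₁)))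
            on-cycle (inj₂ c) (inj₁ (e₁ , e₂)) = inj₂ (σ-injective j _ j<L′ (cyc-next< L′ i i<L′) (trans (at (m≤n⇒m≤1+n w≤p) 1+p<w+L c) (sym e₂)))
            on-cycle (inj₁ c) (inj₂ (e₁ , e₂)) = inj₂ (σ-injective j _ j<L′ (cyc-next< L′ i i<L′) (trans (at w≤p (<-trans (n<1+n p) 1+p<w+L) c) (sym e₂)))
            on-cycle (inj₂ c) (inj₂ (e₁ , e₂)) = inj₁ (σ-injective j i j<L′ i<L′ (trans (at (m≤n⇒m≤1+n w≤p) 1+p<w+L c) (sym e₁)))

        R-distinct : ∀ i j → i < j → j < L′ → ¬ (R i ≡ R j)
        R-distinct i j i<j j<L′ Ri≡Rj with spec i (<-trans i<j j<L′) | spec j j<L′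
        ... | inj₁ (p , Ri≡ , w≤p , 1+p<w+L , trav-i) | inj₁ (q , Rj≡ , w≤q , 1+q<w+L , trav-j) =
               same-edge trav-i trav-j (row-window-injective w p q w≤p (<-trans (n<1+n p) 1+p<w+L) w≤q (<-trans (n<1+n q) 1+q<w+L)
                                                              (trans (sym Ri≡) (trans Ri≡Rj Rj≡)))
          where
            i<L′ : i < L′
            i<L′ = <-trans i<j j<L′
            i≢j : ¬ (i ≡ j)
            i≢j i≡j = <-irrefl i≡j i<j
            same-edge : Traverses i p → Traverses j q → p ≡ q → ⊥
            same-edge (inj₁ (a₁ , _)) (inj₁ (b₁ , _)) refl = i≢j (σ-injective i j i<L′ j<L′ (trans a₁ (sym b₁)))
            same-edge (inj₂ (a₁ , _)) (inj₂ (b₁ , _)) refl = i≢j (σ-injective i j i<L′ j<L′ (trans a₁ (sym b₁)))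
            same-edge (inj₁ (a₁ , a₂)) (inj₂ (b₁ , b₂)) refl =
              cyc-next-asym L′ i j 3≤L′ i<j j<L′ (σ-injective j _ j<L′ (cyc-next< L′ i i<L′) (trans b₁ (sym a₂)))
                                                  (σ-injective i _ i<L′ (cyc-next< L′ j j<L′) (trans a₁ (sym b₂)))
            same-edge (inj₂ (a₁ , a₂)) (inj₁ (b₁ , b₂)) refl =
              cyc-next-asym L′ i j 3≤L′ i<j j<L′ (σ-injective j _ j<L′ (cyc-next< L′ i i<L′) (trans b₁ (sym a₂)))
                                                  (σ-injective i _ i<L′ (cyc-next< L′ j j<L′) (trans a₁ (sym b₂)))
        ... | inj₁ (p , Ri≡ , _) | inj₂ (off , _) = off (p , trans (sym Ri≡) Ri≡Rj)
        ... | inj₂ (off , _) | inj₁ (q , Rj≡ , _) = off (q , trans (sym Rj≡) (sym Ri≡Rj))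
        ... | inj₂ (_ , only-i , _) | inj₂ (_ , _ , hj₁ , hj₂) with only-i j j<L′ (subst (λ z → A z (col (σ j)) ≡ true) (sym Ri≡Rj) hj₁)
        ... | inj₁ j≡i = <-irrefl (sym j≡i) i<j
        ... | inj₂ j≡next with only-i (cyc-next L′ j) (cyc-next< L′ j j<L′) (subst (λ z → A z (col (σ (cyc-next L′ j))) ≡ true) (sym Ri≡Rj) hj₂)
        ... | inj₁ next≡i = cyc-next-asym L′ i j 3≤L′ i<j j<L′ j≡next (sym next≡i)
        ... | inj₂ next≡next = cyc-next-irreflexive L′ j j<L′ (≤-trans (n≤1+n 2) 3≤L′) (trans next≡next (sym j≡next))

        subcycle : HasC A L′
        subcycle = HasC-from-cyc-next A L′ R (λ i → col (σ i)) R-distinct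
                     (λ a b a<b b<L′ e → <-irrefl (col-σ-injective a b (<-trans a<b b<L′) b<L′ e) a<b) R-only R-hits-both

-- Two colour classes on an odd cycle

last-S-even-span : ∀ t1 dtb kb rb L → t1 + (dtb + (kb + rb)) < L → dtb + kb + rb < L
last-S-even-span t1 dtb kb rb L h = ≤-<-trans (m+n≤o⇒m≤o (dtb + kb + rb) (≤-reflexive (e t1 dtb kb rb))) h
  where
    e : ∀ t1 dtb kb rb → dtb + kb + rb + t1 ≡ t1 + (dtb + (kb + rb))
    e = solve-∀

last-S-even-short : ∀ t1 dtb kb rb L → 0 < t1 → 2 ≤ kb → t1 + (dtb + (kb + rb)) < L → dtb + rb + 3 ≤ L
last-S-even-short (suc t1) dtb (suc zero) rb L _ (s≤s ()) h
last-S-even-short (suc t1) dtb (suc (suc kb)) rb L _ _ h = ≤-trans (m+n≤o⇒m≤o (dtb + rb + 3) (≤-reflexive (e t1 dtb kb rb))) (<⇒≤ h)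
  where
    e : ∀ t1 dtb kb rb → dtb + rb + 3 + (t1 + kb) ≡ suc t1 + (dtb + (suc (suc kb) + rb))
    e = solve-∀

last-S-odd-span : ∀ t1 dtb kb rb L → t1 + (dtb + (kb + rb)) < L → t1 + (dtb + kb) + rb < L
last-S-odd-span t1 dtb kb rb L h = subst (_< L) (e t1 dtb kb rb) h
  where
    e : ∀ t1 dtb kb rb → t1 + (dtb + (kb + rb)) ≡ t1 + (dtb + kb) + rb
    e = solve-∀

last-S-odd-short : ∀ t1 dtb kb rb L → 0 < dtb → 0 < kb → t1 + (dtb + (kb + rb)) < L → t1 + rb + 3 ≤ L
last-S-odd-short t1 (suc dtb) (suc kb) rb L _ _ h = ≤-trans (m+n≤o⇒m≤o (t1 + rb + 3) (≤-reflexive (e t1 dtb kb rb))) h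
  where
    e : ∀ t1 dtb kb rb → t1 + rb + 3 + (dtb + kb) ≡ suc (t1 + (suc dtb + (suc kb + rb)))
    e = solve-∀

single-T-span : ∀ t1 dtb q s L → t1 + dtb + (q + s) < L → t1 + (dtb + q) + s < L
single-T-span t1 dtb q s L h = subst (_< L) (e t1 dtb q s) h
  where
    e : ∀ t1 dtb q s → t1 + dtb + (q + s) ≡ t1 + (dtb + q) + s
    e = solve-∀

single-T-short : ∀ t1 dtb q s L → 0 < dtb → 0 < q → t1 + dtb + (q + s) < L → t1 + s + 3 ≤ L
single-T-short t1 (suc dtb) (suc q) s L _ _ h = ≤-trans (m+n≤o⇒m≤o (t1 + s + 3) (≤-reflexive (e t1 dtb q s))) h
  where
    e : ∀ t1 dtb q s → t1 + s + 3 + (dtb + q) ≡ suc (t1 + suc dtb + (suc q + s))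
    e = solve-∀

several-T-even-span : ∀ q kt rt L → q + (kt + rt) < L → q + kt + rt < L
several-T-even-span q kt rt L h = subst (_< L) (sym (+-assoc q kt rt)) h

several-T-even-short : ∀ q kt rt L → 2 ≤ kt → q + (kt + rt) < L → q + rt + 3 ≤ L
several-T-even-short q (suc zero) rt L (s≤s ()) h
several-T-even-short q (suc (suc kt)) rt L _ h = ≤-trans (m+n≤o⇒m≤o (q + rt + 3) (≤-reflexive (e q kt rt))) h
  where
    e : ∀ q kt rt → q + rt + 3 + kt ≡ suc (q + (suc (suc kt) + rt))
    e = solve-∀

several-T-odd-span : ∀ t1 dtb q kt rt L → 0 < t1 → t1 + dtb + (q + (kt + rt)) ≤ L → dtb + (q + kt) + rt < L
several-T-odd-span (suc t1) dtb q kt rt L _ h = ≤-trans (m+n≤o⇒m≤o (suc (dtb + (q + kt) + rt)) (≤-reflexive (e t1 dtb q kt rt))) h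
  where
    e : ∀ t1 dtb q kt rt → suc (dtb + (q + kt) + rt) + t1 ≡ suc t1 + dtb + (q + (kt + rt))
    e = solve-∀

several-T-odd-short : ∀ t1 dtb q kt rt L → 0 < t1 → 0 < q → 0 < kt → t1 + dtb + (q + (kt + rt)) ≤ L → dtb + rt + 3 ≤ L
several-T-odd-short (suc t1) dtb (suc q) (suc kt) rt L _ _ _ h = ≤-trans (m+n≤o⇒m≤o (dtb + rt + 3) (≤-reflexive (e t1 dtb q kt rt))) h
  where
    e : ∀ t1 dtb q kt rt → dtb + rt + 3 + (t1 + q + kt) ≡ suc t1 + dtb + (suc q + (suc kt + rt))
    e = solve-∀

countFrom : (ℕ → Bool) → ℕ → ℕ → ℕ
countFrom P a zero = 0
countFrom P a (suc l) = bit (P a) + countFrom P (suc a) l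

countFrom-+ : ∀ P a l1 l2 → countFrom P a (l1 + l2) ≡ countFrom P a l1 + countFrom P (a + l1) l2
countFrom-+ P a zero l2 = cong (λ z → countFrom P z l2) (sym (+-identityʳ a))
countFrom-+ P a (suc l1) l2 = trans (cong (bit (P a) +_) (trans (countFrom-+ P (suc a) l1 l2) (cong (λ z → countFrom P (suc a) l1 + countFrom P z l2) (sym (+-suc a l1)))))
                              (sym (+-assoc (bit (P a)) _ _))

countFrom-none : ∀ P a l → (∀ i → i < l → P (a + i) ≡ false) → countFrom P a l ≡ 0
countFrom-none P a zero h = refl
countFrom-none P a (suc l) h = cong₂ _+_ (cong bit (subst (λ z → P z ≡ false) (+-identityʳ a) (h 0 (s≤s z≤n))))
                                (countFrom-none P (suc a) l (λ i lt → subst (λ z → P z ≡ false) (+-suc a i) (h (suc i) (s≤s lt))))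

countFrom-single : ∀ P a l → P a ≡ true → (∀ i → 0 < i → i < suc l → P (a + i) ≡ false) → countFrom P a (suc l) ≡ 1
countFrom-single P a l pa h rewrite pa = cong suc (countFrom-none P (suc a) l (λ i lt → subst (λ z → P z ≡ false) (+-suc a i) (h (suc i) (s≤s z≤n) (s≤s lt))))

countFrom>0⇒∃ : ∀ P a l → ¬ (countFrom P a l ≡ 0) → ∃ λ i → i < l × P (a + i) ≡ true
countFrom>0⇒∃ P a zero ne = ⊥-elim (ne refl)
countFrom>0⇒∃ P a (suc l) ne with P a in e
... | true = 0 , s≤s z≤n , trans (cong P (+-identityʳ a)) e
... | false with countFrom>0⇒∃ P (suc a) l ne
... | i , lt , p = suc i , s≤s lt , trans (cong P (+-suc a i)) p

between-sub : ∀ (X : ℕ → Bool) a d → (∀ i → 0 < i → i < d → X (a + i) ≡ false) →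
         ∀ o d' → o + d' ≤ d → ∀ i → 0 < i → i < d' → X (a + o + i) ≡ false
between-sub X a d h o d' le i ip il = trans (cong X (+-assoc a o i))
   (h (o + i) (<-≤-trans ip (m≤n+m i o)) (<-≤-trans (+-monoʳ-< o il) le))

pred< : ∀ {s} → 0 < s → ℕ.pred s < s
pred< {suc s} _ = n<1+n s

<⇒∃+ : ∀ {a b} → a < b → ∃ λ c → b ≡ a + c × 0 < c
<⇒∃+ {a} {b} lt = b ∸ a , sym (m+[n∸m]≡n (<⇒≤ lt)) , m<n⇒0<n∸m lt

module TwoColours (L₀ : ℕ) (S T : ℕ → Bool) where
  L : ℕ
  L = suc L₀

  Gap : (ℕ → Bool) → ℕ → ℕ → Set
  Gap X a d = 0 < d × d < L × X a ≡ true × X (a + d) ≡ true × (∀ i → 0 < i → i < d → X (a + i) ≡ false)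

  module Colour (L-odd : isOdd L ≡ true) (X : ℕ → Bool) (X-periodic : ∀ i → X (i + L) ≡ X i)
            (X-recurs : ∀ a → ∃ λ d → 0 < d × d < L × X (a + d) ≡ true)
            (X-gaps-odd : ∀ a d → Gap X a d → isOdd d ≡ true) where

    next-point : ∀ a → ∃ λ d → 0 < d × d < L × X (a + d) ≡ true × (∀ i → 0 < i → i < d → X (a + i) ≡ false)
    next-point a with X-recurs a
    ... | suc d0 , _ , lt , x with least-witness (λ j → X (a + suc j)) d0 x
    ... | k , le , xk , h = suc k , s≤s z≤n , ≤-<-trans (s≤s le) lt , xk , h'
      where
        h' : ∀ i → 0 < i → i < suc k → X (a + i) ≡ false
        h' (suc j) _ (s≤s lt') = h j lt'

    gap-induction : (NextT : ℕ → ℕ → Set) → (∀ a → NextT a 0) → (∀ a d l → Gap X a d → NextT (a + d) l → NextT a (d + l)) →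
             ∀ l a → X a ≡ true → X (a + l) ≡ true → NextT a l
    gap-induction NextT base step l = go (suc l) l (n<1+n l)
      where
        go : ∀ fuel l → l < fuel → ∀ a → X a ≡ true → X (a + l) ≡ true → NextT a l
        go (suc fuel) zero _ a xa xl = base a
        go (suc fuel) (suc l) (s≤s lf) a xa xl with next-point a
        ... | d , dp , dL , xd , int with ≤-<-connex d (suc l)
        ... | inj₂ sl<d = ⊥-elim (true≢false (trans (sym xl) (int (suc l) (s≤s z≤n) sl<d)))
        ... | inj₁ d≤ = subst (NextT a) (m+[n∸m]≡n d≤)
                (step a d (suc l ∸ d) (dp , dL , xa , xd , int)
                  (go fuel (suc l ∸ d) (<-≤-trans (∸-monoʳ-< {suc l} {d} {0} dp d≤) lf)
                      (a + d) xd (subst (λ z → X z ≡ true) (trans (cong (a +_) (sym (m+[n∸m]≡n d≤))) (sym (+-assoc a d _))) xl)))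

    isOdd-countFrom : ∀ l a → X a ≡ true → X (a + l) ≡ true → isOdd l ≡ isOdd (countFrom X a l)
    isOdd-countFrom = gap-induction (λ a l → isOdd l ≡ isOdd (countFrom X a l)) (λ a → refl) st
      where
        st : ∀ a d l → Gap X a d → isOdd l ≡ isOdd (countFrom X (a + d) l) → isOdd (d + l) ≡ isOdd (countFrom X a (d + l))
        st a (suc d') l arc@(dp , dL , xa , xd , int) ih =
          trans (isOdd-+ (suc d') l)
           (trans (cong (_xor isOdd l) (X-gaps-odd a (suc d') arc))
            (trans (cong not ih)
             (trans (cong (λ z → isOdd (z + countFrom X (a + suc d') l)) (sym (countFrom-single X a d' xa (λ i p q → int i p q))))
                    (cong isOdd (sym (countFrom-+ X a (suc d') l))))))

    period-count-odd : ∀ a → X a ≡ true → isOdd (countFrom X a L) ≡ true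
    period-count-odd a xa = trans (sym (isOdd-countFrom L a xa (trans (X-periodic a) xa))) L-odd

    countFrom-shift : ∀ a → countFrom X a L ≡ countFrom X (suc a) L
    countFrom-shift a = trans (+-comm (bit (X a)) (countFrom X (suc a) L₀))
                   (trans (cong (countFrom X (suc a) L₀ +_) (trans (sym (+-identityʳ (bit (X a))))
                            (cong (λ z → bit z + 0) (sym (trans (cong X (sym (+-suc a L₀))) (X-periodic a))))))
                     (trans (sym (countFrom-+ X (suc a) L₀ 1)) (cong (countFrom X (suc a)) (+-comm L₀ 1))))

    countFrom-anchor : ∀ a → countFrom X a L ≡ countFrom X 0 L
    countFrom-anchor zero = refl
    countFrom-anchor (suc a) = trans (sym (countFrom-shift a)) (countFrom-anchor a)

  -- Some S-gap contains an odd number of T-points, since otherwise a period would contain an even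
  -- number of them; the transitions at the ends of that gap, or of the neighbouring gaps when it holds a
  -- single T-point, form a short odd pair.
  module DisjointColours (L-odd : isOdd L ≡ true)
    (S-periodic : ∀ i → S (i + L) ≡ S i) (T-periodic : ∀ i → T (i + L) ≡ T i)
    (disjoint : ∀ i → S i ≡ true → T i ≡ false)
    (S-recurs : ∀ a → ∃ λ d → 0 < d × d < L × S (a + d) ≡ true)
    (T-recurs : ∀ a → ∃ λ d → 0 < d × d < L × T (a + d) ≡ true)
    (S-gaps-odd : ∀ a d → Gap S a d → isOdd d ≡ true) (T-gaps-odd : ∀ a d → Gap T a d → isOdd d ≡ true)
    (S-nonempty : ∃ λ a → S a ≡ true) (T-nonempty : ∃ λ a → T a ≡ true) where

    module S-colour = Colour L-odd S S-periodic S-recurs S-gaps-odd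
    module T-colour = Colour L-odd T T-periodic T-recurs T-gaps-odd

    T⇒¬S : ∀ i → T i ≡ true → S i ≡ false
    T⇒¬S i ti = ¬-not λ si → true≢false (trans (sym ti) (disjoint i si))

    Transition : ℕ → ℕ → Set
    Transition e d = 0 < d × ((S e ≡ true × T (e + d) ≡ true) ⊎ (T e ≡ true × S (e + d) ≡ true)) ×
                (∀ i → 0 < i → i < d → S (e + i) ≡ false × T (e + i) ≡ false)

    -- Closed up by an S-row and a T-row, such a pair is an odd cycle shorter than L.
    ShortOddPair : Set
    ShortOddPair = Σ ℕ λ e → Σ ℕ λ d1 → Σ ℕ λ g → Σ ℕ λ d2 → 0 < g × d1 + g + d2 < L × d1 + d2 + 3 ≤ L ×
               Transition e d1 × Transition (e + d1 + g) d2 × isOdd (d1 + d2) ≡ true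

    module NoShortOddPair (no-pair : ShortOddPair → ⊥) where

      some-gap-has-odd-T-count : (∀ a d → Gap S a d → isOdd (countFrom T a d) ≡ true → ⊥) → ⊥
      some-gap-has-odd-T-count h = true≢false (trans (sym (T-colour.period-count-odd t0 tt0)) (trans (cong isOdd (trans (T-colour.countFrom-anchor t0) (sym (T-colour.countFrom-anchor s0)))) ev))
        where
          s0 : ℕ
          s0 = proj₁ S-nonempty
          ss0 : S s0 ≡ true
          ss0 = proj₂ S-nonempty
          t0 : ℕ
          t0 = proj₁ T-nonempty
          tt0 : T t0 ≡ true
          tt0 = proj₂ T-nonempty
          st : ∀ a d l → Gap S a d → isOdd (countFrom T (a + d) l) ≡ false → isOdd (countFrom T a (d + l)) ≡ false
          st a d l arc ih with isOdd (countFrom T a d) in e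
          ... | true = ⊥-elim (h a d arc e)
          ... | false = trans (cong isOdd (countFrom-+ T a d l)) (trans (isOdd-+ (countFrom T a d) (countFrom T (a + d) l)) (trans (cong (_xor isOdd (countFrom T (a + d) l)) e) ih))
          ev : isOdd (countFrom T s0 L) ≡ false
          ev = S-colour.gap-induction (λ a l → isOdd (countFrom T a l) ≡ false) (λ a → refl) st L s0 ss0 (trans (S-periodic s0) ss0)

      cong-assoc : ∀ (X : ℕ → Bool) x y z → X (x + y + z) ≡ X (x + (y + z))
      cong-assoc X x y z = cong X (+-assoc x y z)

      several-T-in-gap : ∀ a t1 k r → S a ≡ true → S (a + (t1 + (k + r))) ≡ true → t1 + (k + r) < L →
              (∀ i → 0 < i → i < t1 + (k + r) → S (a + i) ≡ false) → (∀ i → i < t1 → T (a + i) ≡ false) →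
              T (a + t1) ≡ true → T (a + t1 + k) ≡ true →
              (∀ j → k < j → j ≤ (k + r) ∸ 1 → T (a + t1 + j) ≡ false) →
              0 < t1 → 0 < k → 0 < r → isOdd (countFrom T a (t1 + (k + r))) ≡ true → isOdd (t1 + (k + r)) ≡ true → ⊥
      several-T-in-gap a t1 k (suc r') sa sb dL sint tless tt tk tafter t1p kp rp podd pd =
        no-pair (a , t1 , k , r , kp , dL' , d3 , TA , TB , par-t1r)
        where
          r : ℕ
          r = suc r'
          c : ℕ
          c = countFrom T (a + t1) k
          c0 : countFrom T a t1 ≡ 0
          c0 = countFrom-none T a t1 tless
          c1 : countFrom T (a + t1 + k) r ≡ 1
          c1 = countFrom-single T (a + t1 + k) r' tk (λ i ip il → trans (cong-assoc T (a + t1) k i)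
                 (tafter (k + i) (m<m+n k ip) (subst (k + i ≤_) (sym (+-∸-assoc k {r} {1} (s≤s z≤n))) (+-monoʳ-≤ k (≤-pred il)))))
          ctot : countFrom T a (t1 + (k + r)) ≡ c + 1
          ctot = trans (countFrom-+ T a t1 (k + r)) (trans (cong₂ _+_ c0 (countFrom-+ T (a + t1) k r)) (cong (c +_) c1))
          pc : isOdd c ≡ false
          pc = xor-true⇒false (isOdd c) (trans (sym (isOdd-+ c 1)) (trans (cong isOdd (sym ctot)) podd))
            where
              xor-true⇒false : ∀ b → b xor true ≡ true → b ≡ false
              xor-true⇒false false _ = refl
              xor-true⇒false true ()
          pk : isOdd k ≡ false
          pk = trans (T-colour.isOdd-countFrom k (a + t1) tt tk) pc
          dL' : t1 + k + r < L
          dL' = subst (_< L) (sym (+-assoc t1 k r)) dL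
          k2 : 2 ≤ k
          k2 = even-pos⇒2≤ k kp pk
          d3 : t1 + r + 3 ≤ L
          d3 = ≤-trans (≤-trans (≤-reflexive (arith t1 r)) (+-monoʳ-≤ (suc t1) (+-monoˡ-≤ r k2))) (≤-trans (≤-reflexive (arith2 t1 k r)) dL)
            where
              arith : ∀ t1 r → t1 + r + 3 ≡ suc t1 + (2 + r)
              arith = solve-∀
              arith2 : ∀ t1 k r → suc t1 + (k + r) ≡ suc (t1 + (k + r))
              arith2 = solve-∀
          TA : Transition a t1
          TA = t1p , inj₁ (sa , tt) , λ i ip il → sint i ip (<-≤-trans il (m≤m+n t1 (k + r))) , tless i il
          TB : Transition (a + t1 + k) r
          TB = rp , inj₂ (tk , trans (cong S (arith3 a t1 k r)) sb) ,
               λ i ip il → trans (cong S (arith4 a t1 k i)) (sint (t1 + (k + i)) (<-≤-trans t1p (m≤m+n t1 _)) (+-monoʳ-< t1 (+-monoʳ-< k il))) ,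
                           trans (cong-assoc T (a + t1) k i) (tafter (k + i) (m<m+n k ip) (subst (k + i ≤_) (sym (+-∸-assoc k {r} {1} (s≤s z≤n))) (+-monoʳ-≤ k (≤-pred il))))
            where
              arith3 : ∀ a t1 k r → a + t1 + k + r ≡ a + (t1 + (k + r))
              arith3 = solve-∀
              arith4 : ∀ a t1 k i → a + t1 + k + i ≡ a + (t1 + (k + i))
              arith4 = solve-∀
          par-t1r : isOdd (t1 + r) ≡ true
          par-t1r = isOdd-skip-even t1 k r pd pk

      module SingleTInGap (a t1 dtb : ℕ) (sa : S a ≡ true) (sb : S (a + t1 + dtb) ≡ true) (dL : t1 + dtb < L)
                 (sint : ∀ i → 0 < i → i < t1 + dtb → S (a + i) ≡ false)
                 (tless : ∀ i → i < t1 → T (a + i) ≡ false) (tt : T (a + t1) ≡ true)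
                 (tafter : ∀ i → 0 < i → i < dtb → T (a + t1 + i) ≡ false)
                 (t1p : 0 < t1) (dtbp : 0 < dtb) (pd : isOdd (t1 + dtb) ≡ true) where

        TA : Transition a t1
        TA = t1p , inj₁ (sa , tt) , λ i ip il → sint i ip (<-≤-trans il (m≤m+n t1 dtb)) , tless i il

        TTB : Transition (a + t1) dtb
        TTB = dtbp , inj₂ (tt , sb) , λ i ip il → between-sub S a (t1 + dtb) sint t1 dtb ≤-refl i ip il , tafter i ip il

        module NextT (q : ℕ) (qp : 0 < q) (tdt : T (a + t1 + (dtb + q)) ≡ true) (dtL : dtb + q < L)
                 (tint : ∀ i → 0 < i → i < dtb + q → T (a + t1 + i) ≡ false)
                 (tbound : t1 + (dtb + q) < L) where

          tdt' : T (a + t1 + dtb + q) ≡ true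
          tdt' = trans (cong T (+-assoc (a + t1) dtb q)) tdt

          arcT : Gap T (a + t1) (dtb + q)
          arcT = <-≤-trans dtbp (m≤m+n dtb q) , dtL , tt , tdt , tint

          pT : isOdd (dtb + q) ≡ true
          pT = T-gaps-odd _ _ arcT

          last-S-before-next-T : ∀ kb rb → q ≡ kb + rb → S (a + t1 + dtb + kb) ≡ true →
                  (∀ j → kb < j → j < kb + rb → S (a + t1 + dtb + j) ≡ false) → 0 < kb → 0 < rb → ⊥
          last-S-before-next-T kb rb refl skb safter kbp rbp with isOdd kb in pk
          ... | false = no-pair (a + t1 , dtb , kb , rb , kbp , last-S-even-span t1 dtb kb rb L tbound ,
                                       last-S-even-short t1 dtb kb rb L t1p (even-pos⇒2≤ kb kbp pk) tbound , TTB , TB' ,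
                                       isOdd-skip-even dtb kb rb pT pk)
            where
              TB' : Transition (a + t1 + dtb + kb) rb
              TB' = rbp , inj₁ (skb , trans (cong T (e1 a t1 dtb kb rb)) tdt) ,
                    λ i ip il → trans (cong-assoc S (a + t1 + dtb) kb i) (safter (kb + i) (m<m+n kb ip) (+-monoʳ-< kb il)) ,
                                trans (cong T (e2 a t1 dtb kb i)) (tint (dtb + (kb + i)) (<-≤-trans dtbp (m≤m+n dtb _)) (+-monoʳ-< dtb (+-monoʳ-< kb il)))
                where
                  e1 : ∀ a t1 dtb kb rb → a + t1 + dtb + kb + rb ≡ a + t1 + (dtb + (kb + rb))
                  e1 = solve-∀
                  e2 : ∀ a t1 dtb kb i → a + t1 + dtb + kb + i ≡ a + t1 + (dtb + (kb + i))
                  e2 = solve-∀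
          ... | true = no-pair (a , t1 , dtb + kb , rb , <-≤-trans dtbp (m≤m+n dtb kb) , last-S-odd-span t1 dtb kb rb L tbound ,
                                       last-S-odd-short t1 dtb kb rb L dtbp kbp tbound , TA , TB'' ,
                                       isOdd-bridge t1 dtb kb rb pd pT pk)
            where
              TB'' : Transition (a + t1 + (dtb + kb)) rb
              TB'' = subst (λ z → Transition z rb) (+-assoc (a + t1) dtb kb)
                    (rbp , inj₁ (skb , trans (cong T (e1 a t1 dtb kb rb)) tdt) ,
                    λ i ip il → trans (cong-assoc S (a + t1 + dtb) kb i) (safter (kb + i) (m<m+n kb ip) (+-monoʳ-< kb il)) ,
                                trans (cong T (e2 a t1 dtb kb i)) (tint (dtb + (kb + i)) (<-≤-trans dtbp (m≤m+n dtb _)) (+-monoʳ-< dtb (+-monoʳ-< kb il))))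
                where
                  e1 : ∀ a t1 dtb kb rb → a + t1 + dtb + kb + rb ≡ a + t1 + (dtb + (kb + rb))
                  e1 = solve-∀
                  e2 : ∀ a t1 dtb kb i → a + t1 + dtb + kb + i ≡ a + t1 + (dtb + (kb + i))
                  e2 = solve-∀

          module NoSBeforeNextT (safter0 : ∀ j → 0 < j → j < q → S (a + t1 + dtb + j) ≡ false) where
            TBq : Transition (a + t1 + dtb) q
            TBq = qp , inj₁ (sb , tdt') , λ i ip il → safter0 i ip il ,
                    trans (cong T (+-assoc (a + t1) dtb i)) (tint (dtb + i) (<-≤-trans dtbp (m≤m+n dtb i)) (+-monoʳ-< dtb il))

            single-T-in-next-gap : ∀ s → 0 < s → S (a + t1 + dtb + (q + s)) ≡ true → q + s < L →
                   (∀ i → 0 < i → i < q + s → S (a + t1 + dtb + i) ≡ false) →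
                   t1 + dtb + (q + s) ≤ L →
                   (∀ j → 0 < j → j < s → T (a + t1 + dtb + q + j) ≡ false) → ⊥
            single-T-in-next-gap s sp sdb dbL sint2 bnd tafter2 =
              no-pair (a , t1 , dtb + q , s , <-≤-trans dtbp (m≤m+n dtb q) , single-T-span t1 dtb q s L lt , single-T-short t1 dtb q s L dtbp qp lt , TA , TTs , parity)
              where
                pS : isOdd (q + s) ≡ true
                pS = S-gaps-odd (a + t1 + dtb) (q + s) (<-≤-trans qp (m≤m+n q s) , dbL , sb , sdb , sint2)
                lt : t1 + dtb + (q + s) < L
                lt = ≤∧≢⇒< bnd (odd+odd≢L (t1 + dtb) (q + s) pd pS)
                  where
                    odd+odd≢L : ∀ x y → isOdd x ≡ true → isOdd y ≡ true → ¬ (x + y ≡ L)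
                    odd+odd≢L x y hx hy e = true≢false (trans (sym L-odd) (trans (cong isOdd (sym e)) (trans (isOdd-+ x y) (cong₂ _xor_ hx hy))))
                TTs : Transition (a + t1 + (dtb + q)) s
                TTs = sp , inj₂ (tdt , trans (cong S (e1 a t1 dtb q s)) sdb) ,
                      λ i ip il → trans (cong S (e2 a t1 dtb q i)) (sint2 (q + i) (<-≤-trans qp (m≤m+n q i)) (+-monoʳ-< q il)) ,
                                  trans (cong T (e3 a t1 dtb q i)) (tafter2 i ip il)
                  where
                    e1 : ∀ a t1 dtb q s → a + t1 + (dtb + q) + s ≡ a + t1 + dtb + (q + s)
                    e1 = solve-∀
                    e2 : ∀ a t1 dtb q i → a + t1 + (dtb + q) + i ≡ a + t1 + dtb + (q + i)
                    e2 = solve-∀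
                    e3 : ∀ a t1 dtb q i → a + t1 + (dtb + q) + i ≡ a + t1 + dtb + q + i
                    e3 = solve-∀
                parity : isOdd (t1 + s) ≡ true
                parity = isOdd-chain t1 dtb q s pd pT pS

            several-T-in-next-gap : ∀ kt rt → 0 < kt → 0 < rt → S (a + t1 + dtb + (q + (kt + rt))) ≡ true → q + (kt + rt) < L →
                    (∀ i → 0 < i → i < q + (kt + rt) → S (a + t1 + dtb + i) ≡ false) →
                    t1 + dtb + (q + (kt + rt)) ≤ L → T (a + t1 + dtb + q + kt) ≡ true →
                    (∀ j → kt < j → j < kt + rt → T (a + t1 + dtb + q + j) ≡ false) → ⊥
            several-T-in-next-gap kt rt ktp rtp sdb dbL sint2 bnd tkt tafter2 with isOdd kt in pk
            ... | false = no-pair (a + t1 + dtb , q , kt , rt , ktp , several-T-even-span q kt rt L dbL , several-T-even-short q kt rt L (even-pos⇒2≤ kt ktp pk) dbL , TBq , TL ,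
                                         isOdd-skip-even q kt rt pS pk)
              where
                pS : isOdd (q + (kt + rt)) ≡ true
                pS = S-gaps-odd (a + t1 + dtb) (q + (kt + rt)) (<-≤-trans qp (m≤m+n q _) , dbL , sb , sdb , sint2)
                TL : Transition (a + t1 + dtb + q + kt) rt
                TL = rtp , inj₂ (tkt , trans (cong S (e1 a t1 dtb q kt rt)) sdb) ,
                     λ i ip il → trans (cong S (e2 a t1 dtb q kt i)) (sint2 (q + (kt + i)) (<-≤-trans qp (m≤m+n q _)) (+-monoʳ-< q (+-monoʳ-< kt il))) ,
                                 trans (cong-assoc T (a + t1 + dtb + q) kt i) (tafter2 (kt + i) (m<m+n kt ip) (+-monoʳ-< kt il))
                  where
                    e1 : ∀ a t1 dtb q kt rt → a + t1 + dtb + q + kt + rt ≡ a + t1 + dtb + (q + (kt + rt))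
                    e1 = solve-∀
                    e2 : ∀ a t1 dtb q kt i → a + t1 + dtb + q + kt + i ≡ a + t1 + dtb + (q + (kt + i))
                    e2 = solve-∀
            ... | true = no-pair (a + t1 , dtb , q + kt , rt , <-≤-trans qp (m≤m+n q kt) , several-T-odd-span t1 dtb q kt rt L t1p bnd , several-T-odd-short t1 dtb q kt rt L t1p qp ktp bnd , TTB , TL' ,
                                         isOdd-bridge dtb q kt rt pT pS pk)
              where
                pS : isOdd (q + (kt + rt)) ≡ true
                pS = S-gaps-odd (a + t1 + dtb) (q + (kt + rt)) (<-≤-trans qp (m≤m+n q _) , dbL , sb , sdb , sint2)
                TL : Transition (a + t1 + dtb + q + kt) rt
                TL = rtp , inj₂ (tkt , trans (cong S (e1 a t1 dtb q kt rt)) sdb) ,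
                     λ i ip il → trans (cong S (e2 a t1 dtb q kt i)) (sint2 (q + (kt + i)) (<-≤-trans qp (m≤m+n q _)) (+-monoʳ-< q (+-monoʳ-< kt il))) ,
                                 trans (cong-assoc T (a + t1 + dtb + q) kt i) (tafter2 (kt + i) (m<m+n kt ip) (+-monoʳ-< kt il))
                  where
                    e1 : ∀ a t1 dtb q kt rt → a + t1 + dtb + q + kt + rt ≡ a + t1 + dtb + (q + (kt + rt))
                    e1 = solve-∀
                    e2 : ∀ a t1 dtb q kt i → a + t1 + dtb + q + kt + i ≡ a + t1 + dtb + (q + (kt + i))
                    e2 = solve-∀
                TL' : Transition (a + t1 + dtb + (q + kt)) rt
                TL' = subst (λ z → Transition z rt) (+-assoc (a + t1 + dtb) q kt) TL

            by-next-S : ⊥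
            by-next-S with S-colour.next-point (a + t1 + dtb)
            ... | db , dbp , dbL , sdb , sint2 with <-cmp q db
            ... | tri> _ _ db<q = true≢false (trans (sym sdb) (safter0 db dbp db<q))
            ... | tri≈ _ refl _ = true≢false (trans (sym tdt') (disjoint _ sdb))
            ... | tri< q<db _ _ with <⇒∃+ q<db
            ... | s , refl , sp = by-last-T-in-next-gap
              where
                bnd : t1 + dtb + (q + s) ≤ L
                bnd with (t1 + dtb + (q + s)) ℕ.≤? L
                ... | yes p = p
                ... | no np = ⊥-elim (true≢false (trans (sym (trans (cong S pos) (trans (S-periodic a) sa))) (sint2 o op ol)))
                  where
                    o : ℕ
                    o = L ∸ (t1 + dtb)
                    op : 0 < o
                    op = m<n⇒0<n∸m dL
                    ol : o < q + s
                    ol = +-cancelˡ-< (t1 + dtb) o (q + s) (subst (_< t1 + dtb + (q + s)) (sym (m+[n∸m]≡n (<⇒≤ dL))) (≰⇒> np))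
                    pos : a + t1 + dtb + o ≡ a + L
                    pos = trans (cong (_+ o) (+-assoc a t1 dtb)) (trans (+-assoc a (t1 + dtb) o) (cong (a +_) (m+[n∸m]≡n (<⇒≤ dL))))
                by-last-T-in-next-gap : ⊥
                by-last-T-in-next-gap with greatest-witness (λ j → T (a + t1 + dtb + q + j)) (ℕ.pred s) (trans (cong T (+-identityʳ _)) tdt')
                ... | zero , _ , _ , tafter2 = single-T-in-next-gap s sp sdb dbL sint2 bnd (λ j jp jl → tafter2 j jp (<⇒≤pred jl))
                ... | suc kt' , kt≤ , tkt , tafter2 with <⇒∃+ (≤-<-trans kt≤ (pred< sp))
                ... | rt , refl , rtp = several-T-in-next-gap (suc kt') rt (s≤s z≤n) rtp sdb dbL sint2 bnd tkt (λ j lt jl → tafter2 j lt (<⇒≤pred jl))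

          by-S-before-next-T : ⊥
          by-S-before-next-T with greatest-witness (λ j → S (a + t1 + dtb + j)) (ℕ.pred q) (trans (cong S (+-identityʳ _)) sb)
          ... | zero , _ , _ , safter = NoSBeforeNextT.by-next-S (λ j jp jl → safter j jp (<⇒≤pred jl))
          ... | suc kb' , kb≤ , skb , safter with <⇒∃+ (≤-<-trans kb≤ (pred< qp))
          ... | rb , eq , rbp = last-S-before-next-T (suc kb') rb eq skb (λ j lt jl → safter j lt (<⇒≤pred (subst (j <_) (sym eq) jl))) (s≤s z≤n) rbp

        by-next-T : ⊥
        by-next-T with T-colour.next-point (a + t1)
        ... | dt , dtp , dtL , tdt , tint with <-cmp dtb dt
        ... | tri> _ _ dt<dtb = true≢false (trans (sym tdt) (tafter dt dtp dt<dtb))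
        ... | tri≈ _ refl _ = true≢false (trans (sym tdt) (disjoint _ sb))
        ... | tri< dtb<dt _ _ with <⇒∃+ dtb<dt
        ... | q , refl , qp = NextT.by-S-before-next-T q qp tdt dtL tint tbound
          where
            tbound : t1 + (dtb + q) < L
            tbound with (t1 + (dtb + q)) ℕ.<? L
            ... | yes p = p
            ... | no np = ⊥-elim (true≢false (trans (sym (trans (sym (T-periodic (a + o))) (trans (cong T posE) tdt))) (tless o ol)))
              where
                le : L ≤ t1 + (dtb + q)
                le = ≮⇒≥ np
                o : ℕ
                o = t1 + (dtb + q) ∸ L
                ol : o < t1
                ol = +-cancelʳ-< L o t1 (subst (_< t1 + L) (sym (m∸n+n≡m le)) (+-monoʳ-< t1 dtL))
                posE : a + o + L ≡ a + t1 + (dtb + q)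
                posE = trans (+-assoc a o L) (trans (cong (a +_) (m∸n+n≡m le)) (sym (+-assoc a t1 (dtb + q))))

      gap-with-odd-T-count : ∀ a d → Gap S a d → isOdd (countFrom T a d) ≡ true → ⊥
      gap-with-odd-T-count a d (dp , dL , sa , sd , sint) podd with countFrom>0⇒∃ T a d (λ e → true≢false (trans (sym podd) (cong isOdd e)))
      ... | i , il , ti with least-witness (λ j → T (a + j)) i ti
      ... | zero , _ , tt , _ = true≢false (trans (sym tt) (disjoint (a + 0) (trans (cong S (+-identityʳ a)) sa)))
      ... | suc t1' , t1≤ , tt , tless with <⇒∃+ (≤-<-trans t1≤ il)
      ... | dtb , refl , dtbp with greatest-witness (λ j → T (a + suc t1' + j)) (ℕ.pred dtb) (trans (cong T (+-identityʳ _)) tt)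
      ... | zero , _ , _ , tafter =
             SingleTInGap.by-next-T a (suc t1') dtb sa (trans (cong S (+-assoc a (suc t1') dtb)) sd) dL sint tless tt
                     (λ j jp jl → tafter j jp (<⇒≤pred jl)) (s≤s z≤n) dtbp (S-gaps-odd a _ (dp , dL , sa , sd , sint))
      ... | suc k' , k≤ , tk , tafter with <⇒∃+ (≤-<-trans k≤ (pred< dtbp))
      ... | r , refl , rp = several-T-in-gap a (suc t1') (suc k') r sa sd dL sint tless tt tk tafter (s≤s z≤n) (s≤s z≤n) rp podd
                              (S-gaps-odd a _ (dp , dL , sa , sd , sint))

      absurd : ⊥
      absurd = some-gap-has-odd-T-count gap-with-odd-T-count

-- Chord rows of a minimal odd cycle

NoOddHoleAfterDeletion : ∀ {m n} → Matrix m n → Set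
NoOddHoleAfterDeletion {m} {n} A =
  ∀ (j : Fin n) (D : Subset m) → D ⊆ R A j → ∣ D ∣ ≡ ∣ R A j ∣ ∸ 2 → ¬ HasOddHole (IGrows A (∁ D))

module MinimalOddCycle {m n : ℕ} (A : Matrix m n) (linear : Linear A) (L₀ : ℕ) (cycle : Cycles.PeriodicCycle A (suc L₀))
                       (L-odd : isOdd (suc L₀) ≡ true) (5≤L : 5 ≤ suc L₀)
                       (minimal : ∀ L′ → L′ < suc L₀ → 3 ≤ L′ → isOdd L′ ≡ true → HasC A L′ → ⊥) where
  open Cycles A
  open PeriodicCycleLemmas L₀ cycle

  no-rectangle : ∀ x y j₁ j₂ → ¬ (x ≡ y) → ¬ (j₁ ≡ j₂) →
                 A x j₁ ≡ true → A x j₂ ≡ true → A y j₁ ≡ true → A y j₂ ≡ true → ⊥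
  no-rectangle x y j₁ j₂ x≢y j₁≢j₂ a b c d = linear (x , y , j₁ , j₂ , x≢y , j₁≢j₂ , a , b , c , d)

  1<L : 1 < L
  1<L = <-≤-trans (s≤s (s≤s z≤n)) 5≤L

  col≢next : ∀ p → ¬ (col p ≡ col (suc p))
  col≢next p e = col-distinct p 1 (s≤s z≤n) 1<L (trans (cong col (+-comm p 1)) (sym e))

  off-cycle-skips-neighbours : ∀ z → ¬ OnCycle z → ∀ p → A z (col p) ≡ true → A z (col (suc p)) ≡ true → ⊥
  off-cycle-skips-neighbours z off p h₀ h₁ =
    no-rectangle z (row p) (col p) (col (suc p)) (λ e → off (p , sym e)) (col≢next p) h₀ h₁ (row-hits-col p) (row-hits-next p)

  ChordGap : Fin m → ℕ → ℕ → Set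
  ChordGap z a d = 0 < d × d < L × A z (col a) ≡ true × A z (col (a + d)) ≡ true ×
                   (∀ i → 0 < i → i < d → A z (col (a + i)) ≡ false)

  module EvenGap (z : Fin m) (off : ¬ OnCycle z) (a d : ℕ) (za : A z (col a) ≡ true)
                 (zd : A z (col (a + d)) ≡ true) (between : ∀ i → 0 < i → i < d → A z (col (a + i)) ≡ false)
                 (2≤d : 2 ≤ d) (1+d<L : suc d < L) (d-even : isOdd d ≡ false) where

    rows : ℕ → Fin m
    rows i with i ℕ.<? d
    ... | yes _ = row (a + i)
    ... | no _ = z

    open SubCycle (suc d) a (λ i → a + i) rows

    spec : ∀ i → i < suc d → CycleRowSpec i ⊎ ChordRowSpec i
    spec i i≤d with i ℕ.<? d
    ... | yes i<d = inj₁ (a + i , refl , m≤m+n a i , bound , inj₁ (refl , next))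
      where
        bound : suc (a + i) < a + L
        bound = subst (_< a + L) (+-suc a i) (+-monoʳ-< a (<-trans (s≤s i<d) 1+d<L))
        next : a + cyc-next (suc d) i ≡ suc (a + i)
        next = trans (cong (a +_) (cyc-next-mid (suc d) i (s≤s i<d))) (+-suc a i)
    ... | no i≮d with ≤-antisym (≤-pred i≤d) (≮⇒≥ i≮d)
    ... | refl = inj₂ (off , only , zd , subst (λ u → A z (col (a + u)) ≡ true) (sym last) (trans (cong (λ u → A z (col u)) (+-identityʳ a)) za))
      where
        last : cyc-next (suc d) d ≡ 0
        last = cyc-next-last (suc d) d refl
        only : ∀ j → j < suc d → A z (col (a + j)) ≡ true → j ≡ d ⊎ j ≡ cyc-next (suc d) d
        only zero _ _ = inj₂ (sym last)
        only (suc j) j<d h with m≤n⇒m<n∨m≡n (≤-pred j<d)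
        ... | inj₂ 1+j≡d = inj₁ 1+j≡d
        ... | inj₁ 1+j<d = ⊥-elim (true≢false (trans (sym h) (between (suc j) (s≤s z≤n) 1+j<d)))

    absurd : ⊥
    absurd = minimal (suc d) 1+d<L (s≤s 2≤d) (cong not d-even) (subcycle (s≤s 2≤d) window distinct spec)
      where
        window : ∀ i → i < suc d → a ≤ a + i × a + i < a + L
        window i i≤d = m≤m+n a i , +-monoʳ-< a (<-≤-trans i≤d (<⇒≤ 1+d<L))
        distinct : ∀ i j → i < j → j < suc d → ¬ (a + i ≡ a + j)
        distinct i j i<j _ e = <-irrefl (+-cancelˡ-≡ a i j e) i<j

  -- An even gap would close, with the cycle rows it spans, a shorter odd cycle; gaps 1 and L - 1
  -- contradict linearity.
  chord-gaps-odd : ∀ z → ¬ OnCycle z → ∀ a d → ChordGap z a d → isOdd d ≡ true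
  chord-gaps-odd z off a d (0<d , d<L , za , zd , between) with isOdd d in parity
  ... | true = refl
  ... | false = ⊥-elim (even d 0<d d<L zd between parity)
    where
      even : ∀ d → 0 < d → d < L → A z (col (a + d)) ≡ true → (∀ i → 0 < i → i < d → A z (col (a + i)) ≡ false) → isOdd d ≡ false → ⊥
      even (suc zero) _ _ zd _ _ = off-cycle-skips-neighbours z off a za (subst (λ u → A z (col u) ≡ true) (+-comm a 1) zd)
      even (suc (suc d)) _ d<L zd between d-even with m≤n⇒m<n∨m≡n d<L
      ... | inj₁ 1+d<L = EvenGap.absurd z off a (suc (suc d)) za zd between (s≤s (s≤s z≤n)) 1+d<L d-even
      ... | inj₂ 1+d≡L = off-cycle-skips-neighbours z off (a + suc (suc d)) zd
                           (subst (λ u → A z (col u) ≡ true) (sym wraps) (trans (cong (A z) (col-periodic a)) za))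
        where
          wraps : suc (a + suc (suc d)) ≡ a + L
          wraps = trans (sym (+-suc a (suc (suc d)))) (cong (a +_) 1+d≡L)

  two-arc-index : ∀ d₁ d₂ i → i < suc (suc (d₁ + d₂)) →
                  (i < d₁) ⊎ (i ≡ d₁) ⊎ (Σ ℕ λ o → o < d₂ × i ≡ suc d₁ + o) ⊎ (i ≡ suc d₁ + d₂)
  two-arc-index d₁ d₂ i i<L′ with <-cmp i d₁
  ... | tri< i<d₁ _ _ = inj₁ i<d₁
  ... | tri≈ _ i≡d₁ _ = inj₂ (inj₁ i≡d₁)
  ... | tri> _ _ d₁<i with <-cmp (i ∸ suc d₁) d₂
  ... | tri< o<d₂ _ _ = inj₂ (inj₂ (inj₁ (i ∸ suc d₁ , o<d₂ , sym (m+[n∸m]≡n d₁<i))))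
  ... | tri≈ _ o≡d₂ _ = inj₂ (inj₂ (inj₂ (trans (sym (m+[n∸m]≡n d₁<i)) (cong (suc d₁ +_) o≡d₂))))
  ... | tri> _ _ d₂<o = ⊥-elim (<-irrefl refl (<-≤-trans i<L′ (subst (_≤ i) (cong suc (+-suc d₁ d₂))
                          (subst (suc d₁ + suc d₂ ≤_) (m+[n∸m]≡n d₁<i) (+-monoʳ-≤ (suc d₁) d₂<o)))))

  -- The shorter cycle runs along [e, e + d1], jumps through v to e′, runs along [e′, e′ + d2]
  -- and returns through u.
  module CrossingChords (u v : Fin m) (u-off : ¬ OnCycle u) (v-off : ¬ OnCycle v)
               (e d1 g d2 : ℕ) (d1p : 0 < d1) (gp : 0 < g) (d2p : 0 < d2)
               (span<L : d1 + g + d2 < L) (short : d1 + d2 + 3 ≤ L)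
               (ue : A u (col e) ≡ true) (vf : A v (col (e + d1)) ≡ true)
               (ve' : A v (col (e + d1 + g)) ≡ true) (uf' : A u (col (e + d1 + g + d2)) ≡ true)
               (ve : A v (col e) ≡ false) (uf : A u (col (e + d1)) ≡ false)
               (ue' : A u (col (e + d1 + g)) ≡ false) (vf' : A v (col (e + d1 + g + d2)) ≡ false)
               (int1 : ∀ i → 0 < i → i < d1 → A u (col (e + i)) ≡ false × A v (col (e + i)) ≡ false)
               (int2 : ∀ i → 0 < i → i < d2 → A u (col (e + d1 + g + i)) ≡ false × A v (col (e + d1 + g + i)) ≡ false)
               (odd-sum : isOdd (d1 + d2) ≡ true) where
    e′ : ℕ
    e′ = e + d1 + g

    L′ : ℕ
    L′ = suc (suc (d1 + d2))

    σ : ℕ → ℕ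
    σ i with i ℕ.≤? d1
    ... | yes _ = e + i
    ... | no _ = e′ + (i ∸ suc d1)

    σlo : ∀ i → i ≤ d1 → σ i ≡ e + i
    σlo i le with i ℕ.≤? d1
    ... | yes _ = refl
    ... | no n = ⊥-elim (n le)

    σhi : ∀ o → σ (suc d1 + o) ≡ e′ + o
    σhi o with (suc d1 + o) ℕ.≤? d1
    ... | yes le = ⊥-elim (<-irrefl refl (<-≤-trans (m≤m+n (suc d1) o) le))
    ... | no _ = cong (e′ +_) (m+n∸m≡n (suc d1) o)

    rows : ℕ → Fin m
    rows i with i ℕ.<? d1
    ... | yes _ = row (e + i)
    ... | no _ with i ℕ.≟ d1
    ... | yes _ = v
    ... | no _ with i ℕ.<? suc d1 + d2
    ... | yes _ = row (e′ + (i ∸ suc d1))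
    ... | no _ = u

    Rlo : ∀ i → i < d1 → rows i ≡ row (e + i)
    Rlo i lt with i ℕ.<? d1
    ... | yes _ = refl
    ... | no n = ⊥-elim (n lt)

    Rd1 : rows d1 ≡ v
    Rd1 with d1 ℕ.<? d1
    ... | yes l = ⊥-elim (<-irrefl refl l)
    ... | no _ with d1 ℕ.≟ d1
    ... | yes _ = refl
    ... | no n = ⊥-elim (n refl)

    Rhi : ∀ o → o < d2 → rows (suc d1 + o) ≡ row (e′ + o)
    Rhi o ol with (suc d1 + o) ℕ.<? d1
    ... | yes l = ⊥-elim (<-irrefl refl (<-trans (≤-<-trans (m≤m+n d1 o) (n<1+n (d1 + o))) l))
    ... | no _ with (suc d1 + o) ℕ.≟ d1
    ... | yes q = ⊥-elim (<-irrefl (sym q) (≤-<-trans (m≤m+n d1 o) (n<1+n (d1 + o))))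
    ... | no _ with (suc d1 + o) ℕ.<? suc d1 + d2
    ... | yes _ = cong (λ z → row (e′ + z)) (m+n∸m≡n (suc d1) o)
    ... | no n = ⊥-elim (n (+-monoʳ-< (suc d1) ol))

    Rlast : rows (suc d1 + d2) ≡ u
    Rlast with (suc d1 + d2) ℕ.<? d1
    ... | yes l = ⊥-elim (<-irrefl refl (<-trans (≤-<-trans (m≤m+n d1 d2) (n<1+n (d1 + d2))) l))
    ... | no _ with (suc d1 + d2) ℕ.≟ d1
    ... | yes q = ⊥-elim (<-irrefl (sym q) (≤-<-trans (m≤m+n d1 d2) (n<1+n (d1 + d2))))
    ... | no _ with (suc d1 + d2) ℕ.<? suc d1 + d2
    ... | yes l = ⊥-elim (<-irrefl refl l)
    ... | no _ = refl

    open SubCycle L′ e σ rows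

    d1<L : d1 < L
    d1<L = ≤-<-trans (≤-trans (m≤m+n d1 g) (m≤m+n (d1 + g) d2)) span<L

    hiB : ∀ o → o ≤ d2 → e′ + o < e + L
    hiB o le = subst (_< e + L) (sym (trans (+-assoc (e + d1) g o) (+-assoc e d1 (g + o)))) (+-monoʳ-< e (subst (_< L) (+-assoc d1 g o) (≤-<-trans (+-monoʳ-≤ (d1 + g) le) span<L)))

    loB : ∀ i → i ≤ d1 → e + i < e + L
    loB i le = +-monoʳ-< e (≤-<-trans le d1<L)

    lohi : ∀ i → i < L′ → (i ≤ d1) ⊎ (Σ ℕ λ o → o ≤ d2 × i ≡ suc d1 + o)
    lohi i lt with two-arc-index d1 d2 i lt
    ... | inj₁ l = inj₁ (<⇒≤ l)
    ... | inj₂ (inj₁ q) = inj₁ (≤-reflexive q)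
    ... | inj₂ (inj₂ (inj₁ (o , ol , q))) = inj₂ (o , <⇒≤ ol , q)
    ... | inj₂ (inj₂ (inj₂ q)) = inj₂ (d2 , ≤-refl , q)

    σ-window : ∀ i → i < L′ → e ≤ σ i × σ i < e + L
    σ-window i lt with lohi i lt
    ... | inj₁ le rewrite σlo i le = m≤m+n e i , loB i le
    ... | inj₂ (o , le , refl) rewrite σhi o = ≤-trans (≤-trans (m≤m+n e d1) (m≤m+n (e + d1) g)) (m≤m+n e′ o) , hiB o le

    lo<e′ : ∀ i → i ≤ d1 → e + i < e′
    lo<e′ i le = ≤-<-trans (+-monoʳ-≤ e le) (m<m+n (e + d1) gp)

    σ-distinct : ∀ i j → i < j → j < L′ → ¬ (σ i ≡ σ j)
    σ-distinct i j ij jl eq with lohi i (<-trans ij jl) | lohi j jl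
    ... | inj₁ li | inj₁ lj = <-irrefl (+-cancelˡ-≡ e i j (trans (sym (σlo i li)) (trans eq (σlo j lj)))) ij
    ... | inj₁ li | inj₂ (o , _ , refl) = <-irrefl (trans (sym (σlo i li)) (trans eq (σhi o))) (<-≤-trans (lo<e′ i li) (m≤m+n e′ o))
    ... | inj₂ (o , _ , refl) | inj₁ lj = <-irrefl refl (<-≤-trans ij (≤-trans lj (≤-trans (n≤1+n d1) (m≤m+n (suc d1) o))))
    ... | inj₂ (o , _ , refl) | inj₂ (o' , _ , refl) = <-irrefl (cong (suc d1 +_) (+-cancelˡ-≡ e′ o o' (trans (sym (σhi o)) (trans eq (σhi o'))))) ij

    σ0 : σ 0 ≡ e
    σ0 = trans (σlo 0 z≤n) (+-identityʳ e)

    σsd1 : σ (suc d1) ≡ e′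
    σsd1 = trans (cong σ (sym (+-identityʳ (suc d1)))) (trans (σhi 0) (+-identityʳ e′))

    hits-at : ∀ (w : Fin m) k → A w (col k) ≡ true → ∀ k' → k ≡ k' → A w (col k') ≡ true
    hits-at w k h k' refl = h

    miss : ∀ (w : Fin m) k → A w (col k) ≡ true → A w (col k) ≡ false → ∀ {P : Set} → P
    miss w k h h' = ⊥-elim (true≢false (trans (sym h) h'))

    spec : ∀ i → i < L′ → CycleRowSpec i ⊎ ChordRowSpec i
    spec i lt with two-arc-index d1 d2 i lt
    ... | inj₁ ilt = inj₁ (e + i , Rlo i ilt , m≤m+n e i , subst (_< e + L) (+-suc e i) (loB (suc i) ilt) ,
                          inj₁ (σlo i (<⇒≤ ilt) , trans (cong σ (cyc-next-mid L′ i (≤-<-trans ilt (≤-<-trans (m≤m+n d1 d2) (<-trans (n<1+n _) (n<1+n _))))))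
                                                            (trans (σlo (suc i) ilt) (+-suc e i))))
    ... | inj₂ (inj₁ refl) rewrite Rd1 = inj₂ (v-off , onlyV , hits-at v _ vf _ (sym (σlo d1 ≤-refl)) ,
                                              hits-at v _ ve' _ (sym (trans (cong σ (cyc-next-mid L′ d1 (s≤s (s≤s (m≤m+n d1 d2))))) σsd1)))
      where
        onlyV : ∀ j → j < L′ → A v (col (σ j)) ≡ true → j ≡ d1 ⊎ j ≡ cyc-next L′ d1
        onlyV j jl h with two-arc-index d1 d2 j jl
        ... | inj₁ zero<d1 with j
        ... | zero = miss v e (hits-at v _ h _ σ0) ve
        ... | suc j' = miss v _ (hits-at v _ h _ (σlo (suc j') (<⇒≤ zero<d1))) (proj₂ (int1 (suc j') (s≤s z≤n) zero<d1))
        onlyV j jl h | inj₂ (inj₁ q) = inj₁ q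
        onlyV j jl h | inj₂ (inj₂ (inj₁ (zero , ol , q))) = inj₂ (trans q (trans (+-identityʳ (suc d1)) (sym (cyc-next-mid L′ d1 (s≤s (s≤s (m≤m+n d1 d2)))))))
        onlyV j jl h | inj₂ (inj₂ (inj₁ (suc o , ol , refl))) = miss v _ (hits-at v _ h _ (σhi (suc o))) (proj₂ (int2 (suc o) (s≤s z≤n) ol))
        onlyV j jl h | inj₂ (inj₂ (inj₂ refl)) = miss v _ (hits-at v _ h _ (σhi d2)) vf'
    ... | inj₂ (inj₂ (inj₁ (o , ol , refl))) = inj₁ (e′ + o , Rhi o ol , ≤-trans (≤-trans (m≤m+n e d1) (m≤m+n (e + d1) g)) (m≤m+n e′ o) ,
                          subst (_< e + L) (+-suc e′ o) (hiB (suc o) ol) ,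
                          inj₁ (σhi o , trans (cong σ (trans (cyc-next-mid L′ (suc d1 + o) (s≤s (s≤s (subst (_≤ d1 + d2) (+-suc d1 o) (+-monoʳ-≤ d1 ol))))) (sym (+-suc (suc d1) o)))) (trans (σhi (suc o)) (+-suc e′ o))))
    ... | inj₂ (inj₂ (inj₂ refl)) rewrite Rlast = inj₂ (u-off , onlyU , hits-at u _ uf' _ (sym (σhi d2)) ,
                                                       hits-at u _ ue _ (sym (trans (cong σ (cyc-next-last L′ (suc d1 + d2) refl)) σ0)))
      where
        onlyU : ∀ j → j < L′ → A u (col (σ j)) ≡ true → j ≡ suc d1 + d2 ⊎ j ≡ cyc-next L′ (suc d1 + d2)
        onlyU j jl h with two-arc-index d1 d2 j jl
        ... | inj₁ zero<d1 with j
        ... | zero = inj₂ (sym (cyc-next-last L′ (suc d1 + d2) refl))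
        ... | suc j' = miss u _ (hits-at u _ h _ (σlo (suc j') (<⇒≤ zero<d1))) (proj₁ (int1 (suc j') (s≤s z≤n) zero<d1))
        onlyU j jl h | inj₂ (inj₁ refl) = miss u _ (hits-at u _ h _ (σlo d1 ≤-refl)) uf
        onlyU j jl h | inj₂ (inj₂ (inj₁ (zero , ol , refl))) = miss u _ (hits-at u _ h _ σsd1') ue'
          where
            σsd1' = trans (cong σ (+-identityʳ (suc d1))) σsd1
        onlyU j jl h | inj₂ (inj₂ (inj₁ (suc o , ol , refl))) = miss u _ (hits-at u _ h _ (σhi (suc o))) (proj₁ (int2 (suc o) (s≤s z≤n) ol))
        onlyU j jl h | inj₂ (inj₂ (inj₂ q)) = inj₁ q

    absurd : ⊥
    absurd = minimal L′ L′<L (s≤s (s≤s (≤-trans d1p (m≤m+n d1 d2)))) (trans (not-involutive (isOdd (d1 + d2))) odd-sum) (subcycle (s≤s (s≤s (≤-trans d1p (m≤m+n d1 d2)))) σ-window σ-distinct spec)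
      where
        L′<L : L′ < L
        L′<L = subst (_≤ L) (+-comm (d1 + d2) 3) short

  -- As above, but v jumps to e′ + d2 and the second arc is traversed backwards.
  module ParallelChords (u v : Fin m) (u-off : ¬ OnCycle u) (v-off : ¬ OnCycle v)
               (e d1 g d2 : ℕ) (d1p : 0 < d1) (gp : 0 < g) (d2p : 0 < d2)
               (span<L : d1 + g + d2 < L) (short : d1 + d2 + 3 ≤ L)
               (ue : A u (col e) ≡ true) (vf : A v (col (e + d1)) ≡ true)
               (ue' : A u (col (e + d1 + g)) ≡ true) (vf' : A v (col (e + d1 + g + d2)) ≡ true)
               (ve : A v (col e) ≡ false) (uf : A u (col (e + d1)) ≡ false)
               (ve' : A v (col (e + d1 + g)) ≡ false) (uf' : A u (col (e + d1 + g + d2)) ≡ false)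
               (int1 : ∀ i → 0 < i → i < d1 → A u (col (e + i)) ≡ false × A v (col (e + i)) ≡ false)
               (int2 : ∀ i → 0 < i → i < d2 → A u (col (e + d1 + g + i)) ≡ false × A v (col (e + d1 + g + i)) ≡ false)
               (odd-sum : isOdd (d1 + d2) ≡ true) where
    e′ : ℕ
    e′ = e + d1 + g

    L′ : ℕ
    L′ = suc (suc (d1 + d2))

    σ : ℕ → ℕ
    σ i with i ℕ.≤? d1
    ... | yes _ = e + i
    ... | no _ = e′ + (d2 ∸ (i ∸ suc d1))

    σlo : ∀ i → i ≤ d1 → σ i ≡ e + i
    σlo i le with i ℕ.≤? d1
    ... | yes _ = refl
    ... | no n = ⊥-elim (n le)

    σhi : ∀ o → σ (suc d1 + o) ≡ e′ + (d2 ∸ o)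
    σhi o with (suc d1 + o) ℕ.≤? d1
    ... | yes le = ⊥-elim (<-irrefl refl (<-≤-trans (m≤m+n (suc d1) o) le))
    ... | no _ = cong (λ z → e′ + (d2 ∸ z)) (m+n∸m≡n (suc d1) o)

    rows : ℕ → Fin m
    rows i with i ℕ.<? d1
    ... | yes _ = row (e + i)
    ... | no _ with i ℕ.≟ d1
    ... | yes _ = v
    ... | no _ with i ℕ.<? suc d1 + d2
    ... | yes _ = row (e′ + (d2 ∸ suc (i ∸ suc d1)))
    ... | no _ = u

    Rlo : ∀ i → i < d1 → rows i ≡ row (e + i)
    Rlo i lt with i ℕ.<? d1
    ... | yes _ = refl
    ... | no n = ⊥-elim (n lt)

    Rd1 : rows d1 ≡ v
    Rd1 with d1 ℕ.<? d1
    ... | yes l = ⊥-elim (<-irrefl refl l)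
    ... | no _ with d1 ℕ.≟ d1
    ... | yes _ = refl
    ... | no n = ⊥-elim (n refl)

    Rhi : ∀ o → o < d2 → rows (suc d1 + o) ≡ row (e′ + (d2 ∸ suc o))
    Rhi o ol with (suc d1 + o) ℕ.<? d1
    ... | yes l = ⊥-elim (<-irrefl refl (<-trans (≤-<-trans (m≤m+n d1 o) (n<1+n (d1 + o))) l))
    ... | no _ with (suc d1 + o) ℕ.≟ d1
    ... | yes q = ⊥-elim (<-irrefl (sym q) (≤-<-trans (m≤m+n d1 o) (n<1+n (d1 + o))))
    ... | no _ with (suc d1 + o) ℕ.<? suc d1 + d2
    ... | yes _ = cong (λ z → row (e′ + (d2 ∸ suc z))) (m+n∸m≡n (suc d1) o)
    ... | no n = ⊥-elim (n (+-monoʳ-< (suc d1) ol))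

    Rlast : rows (suc d1 + d2) ≡ u
    Rlast with (suc d1 + d2) ℕ.<? d1
    ... | yes l = ⊥-elim (<-irrefl refl (<-trans (≤-<-trans (m≤m+n d1 d2) (n<1+n (d1 + d2))) l))
    ... | no _ with (suc d1 + d2) ℕ.≟ d1
    ... | yes q = ⊥-elim (<-irrefl (sym q) (≤-<-trans (m≤m+n d1 d2) (n<1+n (d1 + d2))))
    ... | no _ with (suc d1 + d2) ℕ.<? suc d1 + d2
    ... | yes l = ⊥-elim (<-irrefl refl l)
    ... | no _ = refl

    open SubCycle L′ e σ rows

    d1<L : d1 < L
    d1<L = ≤-<-trans (≤-trans (m≤m+n d1 g) (m≤m+n (d1 + g) d2)) span<L

    hiB : ∀ o → o ≤ d2 → e′ + o < e + L
    hiB o le = subst (_< e + L) (sym (trans (+-assoc (e + d1) g o) (+-assoc e d1 (g + o)))) (+-monoʳ-< e (subst (_< L) (+-assoc d1 g o) (≤-<-trans (+-monoʳ-≤ (d1 + g) le) span<L)))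

    loB : ∀ i → i ≤ d1 → e + i < e + L
    loB i le = +-monoʳ-< e (≤-<-trans le d1<L)

    lohi : ∀ i → i < L′ → (i ≤ d1) ⊎ (Σ ℕ λ o → o ≤ d2 × i ≡ suc d1 + o)
    lohi i lt with two-arc-index d1 d2 i lt
    ... | inj₁ l = inj₁ (<⇒≤ l)
    ... | inj₂ (inj₁ q) = inj₁ (≤-reflexive q)
    ... | inj₂ (inj₂ (inj₁ (o , ol , q))) = inj₂ (o , <⇒≤ ol , q)
    ... | inj₂ (inj₂ (inj₂ q)) = inj₂ (d2 , ≤-refl , q)

    e≤e' : e ≤ e′
    e≤e' = ≤-trans (m≤m+n e d1) (m≤m+n (e + d1) g)

    σ-window : ∀ i → i < L′ → e ≤ σ i × σ i < e + L
    σ-window i lt with lohi i lt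
    ... | inj₁ le rewrite σlo i le = m≤m+n e i , loB i le
    ... | inj₂ (o , le , refl) rewrite σhi o = ≤-trans e≤e' (m≤m+n e′ (d2 ∸ o)) , hiB (d2 ∸ o) (m∸n≤m d2 o)

    lo<e′ : ∀ i → i ≤ d1 → e + i < e′
    lo<e′ i le = ≤-<-trans (+-monoʳ-≤ e le) (m<m+n (e + d1) gp)

    σ-distinct : ∀ i j → i < j → j < L′ → ¬ (σ i ≡ σ j)
    σ-distinct i j ij jl eq with lohi i (<-trans ij jl) | lohi j jl
    ... | inj₁ li | inj₁ lj = <-irrefl (+-cancelˡ-≡ e i j (trans (sym (σlo i li)) (trans eq (σlo j lj)))) ij
    ... | inj₁ li | inj₂ (o , _ , refl) = <-irrefl (trans (sym (σlo i li)) (trans eq (σhi o))) (<-≤-trans (lo<e′ i li) (m≤m+n e′ _))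
    ... | inj₂ (o , _ , refl) | inj₁ lj = <-irrefl refl (<-≤-trans ij (≤-trans lj (≤-trans (n≤1+n d1) (m≤m+n (suc d1) o))))
    ... | inj₂ (o , ol , refl) | inj₂ (o' , ol' , refl) =
          <-irrefl (cong (suc d1 +_) (∸-cancelˡ-≡ ol ol' (+-cancelˡ-≡ e′ _ _ (trans (sym (σhi o)) (trans eq (σhi o')))))) ij

    σ0 : σ 0 ≡ e
    σ0 = trans (σlo 0 z≤n) (+-identityʳ e)

    σsd1 : σ (suc d1) ≡ e′ + d2
    σsd1 = trans (cong σ (sym (+-identityʳ (suc d1)))) (σhi 0)

    σlast : σ (suc d1 + d2) ≡ e′
    σlast = trans (σhi d2) (trans (cong (e′ +_) (n∸n≡0 d2)) (+-identityʳ e′))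

    hits-at : ∀ (w : Fin m) k → A w (col k) ≡ true → ∀ k' → k ≡ k' → A w (col k') ≡ true
    hits-at w k h k' refl = h

    miss : ∀ (w : Fin m) k → A w (col k) ≡ true → A w (col k) ≡ false → ∀ {P : Set} → P
    miss w k h h' = ⊥-elim (true≢false (trans (sym h) h'))

    midO : ∀ o → 0 < o → o < d2 → 0 < d2 ∸ o × d2 ∸ o < d2
    midO o op ol = m<n⇒0<n∸m ol , ∸-monoʳ-< {d2} {o} {0} op (<⇒≤ ol)

    dsuc : ∀ o → o < d2 → d2 ∸ o ≡ suc (d2 ∸ suc o)
    dsuc o ol = +-∸-assoc 1 ol

    spec : ∀ i → i < L′ → CycleRowSpec i ⊎ ChordRowSpec i
    spec i lt with two-arc-index d1 d2 i lt
    ... | inj₁ ilt = inj₁ (e + i , Rlo i ilt , m≤m+n e i , subst (_< e + L) (+-suc e i) (loB (suc i) ilt) ,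
                          inj₁ (σlo i (<⇒≤ ilt) , trans (cong σ (cyc-next-mid L′ i (≤-<-trans ilt (≤-<-trans (m≤m+n d1 d2) (<-trans (n<1+n _) (n<1+n _))))))
                                                            (trans (σlo (suc i) ilt) (+-suc e i))))
    ... | inj₂ (inj₁ refl) rewrite Rd1 = inj₂ (v-off , onlyV , hits-at v _ vf _ (sym (σlo d1 ≤-refl)) ,
                                              hits-at v _ vf' _ (sym (trans (cong σ (cyc-next-mid L′ d1 (s≤s (s≤s (m≤m+n d1 d2))))) σsd1)))
      where
        onlyV : ∀ j → j < L′ → A v (col (σ j)) ≡ true → j ≡ d1 ⊎ j ≡ cyc-next L′ d1
        onlyV j jl h with two-arc-index d1 d2 j jl
        ... | inj₁ zero<d1 with j
        ... | zero = miss v e (hits-at v _ h _ σ0) ve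
        ... | suc j' = miss v _ (hits-at v _ h _ (σlo (suc j') (<⇒≤ zero<d1))) (proj₂ (int1 (suc j') (s≤s z≤n) zero<d1))
        onlyV j jl h | inj₂ (inj₁ q) = inj₁ q
        onlyV j jl h | inj₂ (inj₂ (inj₁ (zero , ol , q))) = inj₂ (trans q (trans (+-identityʳ (suc d1)) (sym (cyc-next-mid L′ d1 (s≤s (s≤s (m≤m+n d1 d2)))))))
        onlyV j jl h | inj₂ (inj₂ (inj₁ (suc o , ol , refl))) = miss v _ (hits-at v _ h _ (σhi (suc o))) (proj₂ (int2 (d2 ∸ suc o) (proj₁ mo) (proj₂ mo)))
          where
            mo = midO (suc o) (s≤s z≤n) ol
        onlyV j jl h | inj₂ (inj₂ (inj₂ refl)) = miss v _ (hits-at v _ h _ σlast) ve'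
    ... | inj₂ (inj₂ (inj₁ (o , ol , refl))) = inj₁ (e′ + (d2 ∸ suc o) , Rhi o ol , ≤-trans e≤e' (m≤m+n e′ _) ,
                          subst (_< e + L) (trans (cong (e′ +_) (dsuc o ol)) (+-suc e′ _)) (hiB (d2 ∸ o) (m∸n≤m d2 o)) ,
                          inj₂ (trans (σhi o) (trans (cong (e′ +_) (dsuc o ol)) (+-suc e′ _)) ,
                                trans (cong σ (trans (cyc-next-mid L′ (suc d1 + o) (s≤s (s≤s (subst (_≤ d1 + d2) (+-suc d1 o) (+-monoʳ-≤ d1 ol))))) (sym (+-suc (suc d1) o)))) (σhi (suc o))))
    ... | inj₂ (inj₂ (inj₂ refl)) rewrite Rlast = inj₂ (u-off , onlyU , hits-at u _ ue' _ (sym σlast) ,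
                                                       hits-at u _ ue _ (sym (trans (cong σ (cyc-next-last L′ (suc d1 + d2) refl)) σ0)))
      where
        onlyU : ∀ j → j < L′ → A u (col (σ j)) ≡ true → j ≡ suc d1 + d2 ⊎ j ≡ cyc-next L′ (suc d1 + d2)
        onlyU j jl h with two-arc-index d1 d2 j jl
        ... | inj₁ zero<d1 with j
        ... | zero = inj₂ (sym (cyc-next-last L′ (suc d1 + d2) refl))
        ... | suc j' = miss u _ (hits-at u _ h _ (σlo (suc j') (<⇒≤ zero<d1))) (proj₁ (int1 (suc j') (s≤s z≤n) zero<d1))
        onlyU j jl h | inj₂ (inj₁ refl) = miss u _ (hits-at u _ h _ (σlo d1 ≤-refl)) uf
        onlyU j jl h | inj₂ (inj₂ (inj₁ (zero , ol , refl))) = miss u _ (hits-at u _ h _ σsd1') uf'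
          where
            σsd1' = trans (cong σ (+-identityʳ (suc d1))) σsd1
        onlyU j jl h | inj₂ (inj₂ (inj₁ (suc o , ol , refl))) = miss u _ (hits-at u _ h _ (σhi (suc o))) (proj₁ (int2 (d2 ∸ suc o) (proj₁ mo) (proj₂ mo)))
          where
            mo = midO (suc o) (s≤s z≤n) ol
        onlyU j jl h | inj₂ (inj₂ (inj₂ q)) = inj₁ q

    absurd : ⊥
    absurd = minimal L′ L′<L (s≤s (s≤s (≤-trans d1p (m≤m+n d1 d2)))) (trans (not-involutive (isOdd (d1 + d2))) odd-sum) (subcycle (s≤s (s≤s (≤-trans d1p (m≤m+n d1 d2)))) σ-window σ-distinct spec)
      where
        L′<L : L′ < L
        L′<L = subst (_≤ L) (+-comm (d1 + d2) 3) short

  Chord : Fin m → Set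
  Chord z = ¬ OnCycle z × Σ ℕ λ a → Σ ℕ λ d → 0 < d × d < L × A z (col a) ≡ true × A z (col (a + d)) ≡ true

  hit-ahead : ∀ z a e → a < e → e < a + L → A z (col e) ≡ true → ∃ λ d → 0 < d × d < L × A z (col (a + d)) ≡ true
  hit-ahead z a e a<e e<a+L h = e ∸ a , m<n⇒0<n∸m a<e ,
    +-cancelˡ-< a (e ∸ a) L (subst (_< a + L) (sym (m+[n∸m]≡n (<⇒≤ a<e))) e<a+L) ,
    subst (λ w → A z (col w) ≡ true) (sym (m+[n∸m]≡n (<⇒≤ a<e))) h

  chord-hits-ahead : ∀ z → Chord z → ∀ a → ∃ λ d → 0 < d × d < L × A z (col (a + d)) ≡ true
  chord-hits-ahead z (_ , p , d₀ , 0<d₀ , d₀<L , zp , zpd) a with window-rep a p | window-rep a (p + d₀)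
  ... | e₁ , a<e₁ , e₁≤a+L , e₁≈p | e₂ , a<e₂ , e₂≤a+L , e₂≈p+d₀ with m≤n⇒m<n∨m≡n e₁≤a+L
  ... | inj₁ e₁<a+L = hit-ahead z a e₁ a<e₁ e₁<a+L (trans (cong (A z) (≈⇒col≡ e₁≈p)) zp)
  ... | inj₂ e₁≡a+L with m≤n⇒m<n∨m≡n e₂≤a+L
  ... | inj₁ e₂<a+L = hit-ahead z a e₂ a<e₂ e₂<a+L (trans (cong (A z) (≈⇒col≡ e₂≈p+d₀)) zpd)
  ... | inj₂ e₂≡a+L = ⊥-elim (col-distinct p d₀ 0<d₀ d₀<L (≈⇒col≡ (trans (sym e₂≈p+d₀) (trans (cong (_% L) (trans e₂≡a+L (sym e₁≡a+L))) e₁≈p))))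

  chords-intersect : ∀ x y → Chord x → Chord y → ¬ (∀ i → A x (col i) ≡ true → A y (col i) ≡ false)
  chords-intersect x y cx@(x-off , a , _ , _ , _ , xa , _) cy@(y-off , b , _ , _ , _ , yb , _) disjoint =
    NoShortOddPair.absurd no-short-odd-pair
    where
      S T : ℕ → Bool
      S i = A x (col i)
      T i = A y (col i)
      open TwoColours L₀ S T
      open DisjointColours L-odd (λ i → cong (A x) (col-periodic i)) (λ i → cong (A y) (col-periodic i)) disjoint
             (chord-hits-ahead x cx) (chord-hits-ahead y cy) (chord-gaps-odd x x-off) (chord-gaps-odd y y-off) (a , xa) (b , yb)
      no-short-odd-pair : ShortOddPair → ⊥
      no-short-odd-pair (e , d₁ , g , d₂ , 0<g , span<L , short , (0<d₁ , ends₁ , between₁) , (0<d₂ , ends₂ , between₂) , odd) =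
        by-ends ends₁ ends₂
        where
          by-ends : ((S e ≡ true × T (e + d₁) ≡ true) ⊎ (T e ≡ true × S (e + d₁) ≡ true)) →
                    ((S (e + d₁ + g) ≡ true × T (e + d₁ + g + d₂) ≡ true) ⊎ (T (e + d₁ + g) ≡ true × S (e + d₁ + g + d₂) ≡ true)) → ⊥
          by-ends (inj₁ (xe , yf)) (inj₂ (ye′ , xf′)) =
            CrossingChords.absurd x y x-off y-off e d₁ g d₂ 0<d₁ 0<g 0<d₂ span<L short xe yf ye′ xf′
              (disjoint e xe) (T⇒¬S _ yf) (T⇒¬S _ ye′) (disjoint _ xf′) between₁ between₂ odd
          by-ends (inj₁ (xe , yf)) (inj₁ (xe′ , yf′)) =
            ParallelChords.absurd x y x-off y-off e d₁ g d₂ 0<d₁ 0<g 0<d₂ span<L short xe yf xe′ yf′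
              (disjoint e xe) (T⇒¬S _ yf) (disjoint _ xe′) (T⇒¬S _ yf′) between₁ between₂ odd
          by-ends (inj₂ (ye , xf)) (inj₁ (xe′ , yf′)) =
            CrossingChords.absurd y x y-off x-off e d₁ g d₂ 0<d₁ 0<g 0<d₂ span<L short ye xf xe′ yf′
              (T⇒¬S e ye) (disjoint _ xf) (disjoint _ xe′) (T⇒¬S _ yf′) (λ i 0<i i<d → swap (between₁ i 0<i i<d)) (λ i 0<i i<d → swap (between₂ i 0<i i<d)) odd
          by-ends (inj₂ (ye , xf)) (inj₂ (ye′ , xf′)) =
            ParallelChords.absurd y x y-off x-off e d₁ g d₂ 0<d₁ 0<g 0<d₂ span<L short ye xf ye′ xf′
              (T⇒¬S e ye) (disjoint _ xf) (T⇒¬S _ ye′) (disjoint _ xf′) (λ i 0<i i<d → swap (between₁ i 0<i i<d)) (λ i 0<i i<d → swap (between₂ i 0<i i<d)) odd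

  ≈-pred : ∀ {a b} → suc a ≈ suc b → a ≈ b
  ≈-pred {a} {b} e = trans (sym (+L≈ a)) (trans (subst₂ _≈_ (sym (+-suc a L₀)) (sym (+-suc b L₀)) (≈-+ {suc a} {suc b} L₀ e)) (+L≈ b))

  ≈suc⇒CycSucc : ∀ a b → a < L → b < L → b ≈ suc a → CycSucc L a b
  ≈suc⇒CycSucc a b a<L b<L b≈1+a with suc-%-cases a
  ... | inj₁ (_ , e) = inj₁ (trans (sym (m<n⇒m%n≡m b<L)) (trans b≈1+a (trans e (cong suc (m<n⇒m%n≡m a<L)))))
  ... | inj₂ (1+a%L≡L , e) = inj₂ (trans (cong suc (sym (m<n⇒m%n≡m a<L))) 1+a%L≡L , trans (sym (m<n⇒m%n≡m b<L)) (trans b≈1+a e))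

  module CommonColumn (no-odd-hole : NoOddHoleAfterDeletion A) (p : ℕ) (chords-hit : ∀ z → Chord z → A z (col p) ≡ true) where

    j : Fin n
    j = col p

    r₁ r₂ : Fin m
    r₁ = row (p + L₀)
    r₂ = row (p + L)

    r₁-hits : A r₁ j ≡ true
    r₁-hits = subst (λ c → A r₁ c ≡ true) (trans (cong col (sym (+-suc p L₀))) (col-periodic p)) (row-hits-next (p + L₀))

    r₂-hits : A r₂ j ≡ true
    r₂-hits = subst (λ c → A r₂ c ≡ true) (col-periodic p) (row-hits-col (p + L))

    r₁≢r₂ : ¬ (r₁ ≡ r₂)
    r₁≢r₂ e = row-distinct (p + L₀) 1 (s≤s z≤n) 1<L (trans (cong row (trans (+-assoc p L₀ 1) (cong (p +_) (+-comm L₀ 1)))) (sym e))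

    deleted : Fin m → Bool
    deleted i = (A i j ∧ not (i == r₁)) ∧ not (i == r₂)

    D : Subset m
    D = tabulate deleted

    D⊆R : D ⊆ R A j
    D⊆R {x} x∈D = ∈-tabulate⁺ (λ i → A i j) x (∧-conicalˡ _ _ (∧-conicalˡ _ _ (∈-tabulate⁻ deleted x x∈D)))

    ∣D∣ : ∣ D ∣ ≡ ∣ R A j ∣ ∸ 2
    ∣D∣ = begin
      ∣ D ∣                                 ≡⟨ ones≡count deleted ⟩
      count deleted                         ≡⟨⟩
      2 + count deleted ∸ 2                 ≡⟨ cong (_∸ 2) (cong suc (count-remove (λ i → A i j ∧ not (i == r₁)) r₂ r₂-kept)) ⟨
      suc (count (λ i → A i j ∧ not (i == r₁))) ∸ 2   ≡⟨ cong (_∸ 2) (count-remove (λ i → A i j) r₁ r₁-hits) ⟨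
      count (λ i → A i j) ∸ 2               ≡⟨ cong (_∸ 2) (ones≡count (λ i → A i j)) ⟨
      ∣ R A j ∣ ∸ 2                         ∎
      where
        open ≡-Reasoning
        r₂-kept : (A r₂ j ∧ not (r₂ == r₁)) ≡ true
        r₂-kept = without⁺ (λ i → A i j) r₂-hits (λ e → r₁≢r₂ (sym e))

    cycle-row-kept : ∀ q → deleted (row q) ≡ false
    cycle-row-kept q with A (row q) j in hit
    ... | false = refl
    ... | true with row-only q p hit
    ... | inj₁ e rewrite ≈⇒row≡ {q} {p + L} (trans (col≡⇒≈ (sym e)) (sym (+L≈ p))) | ==-refl r₂ = ∧-zeroʳ _
    ... | inj₂ e rewrite ≈⇒row≡ {q} {p + L₀} (≈-pred (trans (col≡⇒≈ (sym e)) (trans (sym (+L≈ p)) (cong (_% L) (+-suc p L₀)))))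
                       | ==-refl r₁ = refl

    v : Fin L → Fin n
    v t = col (toℕ t)

    hits-next : ∀ q {c} → col (suc q) ≡ c → A (row q) c ≡ true
    hits-next q e = subst (λ c → A (row q) c ≡ true) e (row-hits-next q)

    wraps : ∀ {q t} → suc q ≡ L → t ≡ 0 → col (suc q) ≡ col t
    wraps e₁ e₂ = trans (cong col e₁) (trans (col-periodic 0) (cong col (sym e₂)))

    v-injective : Injective _≡_ _≡_ v
    v-injective = injective-below col λ i k i<k k<L e →
      col-distinct i (k ∸ i) (m<n⇒0<n∸m i<k) (≤-<-trans (m∸n≤m k i) k<L) (trans (cong col (m+[n∸m]≡n (<⇒≤ i<k))) (sym e))

    kept-row-edge : ∀ a b → ¬ (a ≡ b) → ∀ q → A (row q) (v a) ≡ true → A (row q) (v b) ≡ true → IGrows A (∁ D) (v a) (v b)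
    kept-row-edge a b a≢b q ha hb = (λ e → a≢b (v-injective e)) , row q , ∈-∁-tabulate⁺ deleted (row q) (cycle-row-kept q) , ha , hb

    cycle-edge : ∀ a b → ¬ (a ≡ b) → CycAdj L a b → IGrows A (∁ D) (v a) (v b)
    cycle-edge a b a≢b (inj₁ e) =
      kept-row-edge a b a≢b (toℕ a) (row-hits-col (toℕ a)) (hits-next (toℕ a) (cong col (sym e)))
    cycle-edge a b a≢b (inj₂ (inj₁ e)) =
      kept-row-edge a b a≢b (toℕ b) (hits-next (toℕ b) (cong col (sym e))) (row-hits-col (toℕ b))
    cycle-edge a b a≢b (inj₂ (inj₂ (inj₁ (e₁ , e₂)))) =
      kept-row-edge a b a≢b (toℕ a) (row-hits-col (toℕ a)) (hits-next (toℕ a) (wraps e₁ e₂))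
    cycle-edge a b a≢b (inj₂ (inj₂ (inj₂ (e₁ , e₂)))) =
      kept-row-edge a b a≢b (toℕ b) (hits-next (toℕ b) (wraps e₁ e₂)) (row-hits-col (toℕ b))

    cycle-row⇒CycAdj : ∀ a b → ¬ (v a ≡ v b) → ∀ q → A (row q) (v a) ≡ true → A (row q) (v b) ≡ true → CycAdj L a b
    cycle-row⇒CycAdj a b va≢vb q h₁ h₂ with row-only q (toℕ a) h₁ | row-only q (toℕ b) h₂
    ... | inj₁ ea | inj₁ eb = ⊥-elim (va≢vb (trans ea (sym eb)))
    ... | inj₂ ea | inj₂ eb = ⊥-elim (va≢vb (trans ea (sym eb)))
    ... | inj₁ ea | inj₂ eb with ≈suc⇒CycSucc (toℕ a) (toℕ b) (FP.toℕ<n a) (FP.toℕ<n b) (trans (col≡⇒≈ eb) (sym (≈-suc (col≡⇒≈ ea))))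
    ...   | inj₁ s = inj₁ s
    ...   | inj₂ s = inj₂ (inj₂ (inj₁ s))
    cycle-row⇒CycAdj a b va≢vb q h₁ h₂ | inj₂ ea | inj₁ eb
      with ≈suc⇒CycSucc (toℕ b) (toℕ a) (FP.toℕ<n b) (FP.toℕ<n a) (trans (col≡⇒≈ ea) (sym (≈-suc (col≡⇒≈ eb))))
    ...   | inj₁ s = inj₂ (inj₁ s)
    ...   | inj₂ s = inj₂ (inj₂ (inj₂ s))

    kept-rows-on-cycle : ∀ a b i → ¬ (a ≡ b) → i ∈ ∁ D → A i (v a) ≡ true → A i (v b) ≡ true → ¬ ¬ OnCycle i
    kept-rows-on-cycle a b i a≢b i∉D h₁ h₂ off = i-kept (chords-hit i chord)
      where
        chord : Chord i
        chord with <-cmp (toℕ a) (toℕ b)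
        ... | tri< a<b _ _ = off , toℕ a , toℕ b ∸ toℕ a , m<n⇒0<n∸m a<b , ≤-<-trans (m∸n≤m (toℕ b) (toℕ a)) (FP.toℕ<n b) , h₁ ,
                             subst (λ w → A i (col w) ≡ true) (sym (m+[n∸m]≡n (<⇒≤ a<b))) h₂
        ... | tri≈ _ a≡b _ = ⊥-elim (a≢b (FP.toℕ-injective a≡b))
        ... | tri> _ _ b<a = off , toℕ b , toℕ a ∸ toℕ b , m<n⇒0<n∸m b<a , ≤-<-trans (m∸n≤m (toℕ a) (toℕ b)) (FP.toℕ<n a) , h₂ ,
                             subst (λ w → A i (col w) ≡ true) (sym (m+[n∸m]≡n (<⇒≤ b<a))) h₁
        i-kept : A i j ≡ true → ⊥
        i-kept hit with i == r₁ in is-r₁ | i == r₂ in is-r₂ | ∈-∁-tabulate⁻ deleted i i∉D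
        ... | true | _ | _ = off (p + L₀ , sym (==⇒≡ i r₁ is-r₁))
        ... | false | true | _ = off (p + L , sym (==⇒≡ i r₂ is-r₂))
        ... | false | false | not-deleted rewrite hit = true≢false not-deleted

    edge⇒CycAdj : ∀ a b → ¬ (a ≡ b) → IGrows A (∁ D) (v a) (v b) → CycAdj L a b
    edge⇒CycAdj a b a≢b (va≢vb , i , i∉D , h₁ , h₂) with CycAdj? L a b
    ... | yes adj = adj
    ... | no ¬adj = ⊥-elim (kept-rows-on-cycle a b i a≢b i∉D h₁ h₂ λ (q , rq) →
                      ¬adj (cycle-row⇒CycAdj a b va≢vb q (subst (λ w → A w (v a) ≡ true) (sym rq) h₁) (subst (λ w → A w (v b) ≡ true) (sym rq) h₂)))

    absurd : ⊥
    absurd = no-odd-hole j D D⊆R ∣D∣ (L , isOdd⇒Odd L L-odd , v , ≤-trans (n≤1+n 4) 5≤L , v-injective ,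
                                       λ a b a≢b → mk⇔ (edge⇒CycAdj a b a≢b) (cycle-edge a b a≢b))

  module Conclusion (g≥5 : gAtLeast A 5) (no-odd-hole : NoOddHoleAfterDeletion A) where

    chords-meet : ∀ u w → Chord u → Chord w → ¬ ¬ (Σ ℕ λ i → A u (col i) ≡ true × A w (col i) ≡ true)
    chords-meet u w cu cw no-common = chords-intersect u w cu cw λ i ui → ¬-not λ wi → no-common (i , ui , wi)

    some-chord-misses : ∀ p → ¬ ¬ (Σ (Fin m) λ z → Chord z × A z (col p) ≡ false)
    some-chord-misses p none = CommonColumn.absurd no-odd-hole p λ z cz → ¬-not λ miss → none (z , cz , miss)

    no-chord-triangle : ∀ x y z q₁ q q₂ → ¬ (x ≡ y) → ¬ (x ≡ z) → ¬ (y ≡ z) →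
                        A x (col q₁) ≡ true → A x (col q) ≡ true → A y (col q) ≡ true → A y (col q₂) ≡ true →
                        A z (col q₁) ≡ true → A z (col q) ≡ false → A z (col q₂) ≡ true → ⊥
    no-chord-triangle x y z q₁ q q₂ x≢y x≢z y≢z xq₁ xq yq yq₂ zq₁ zq zq₂ =
      Bool-cases (A x (col q₂)) (λ xq₂ → no-rectangle x y (col q) (col q₂) x≢y c₁≢c₂ xq xq₂ yq yq₂) λ xq₂ →
      Bool-cases (A y (col q₁)) (λ yq₁ → no-rectangle x y (col q) (col q₁) x≢y (λ e → c₀≢c₁ (sym e)) xq xq₁ yq yq₁) λ yq₁ →
      5≰3 (g≥5 3 ≤-refl (1 , refl) (triangle⇒HasC3 A x y z (col q₁) (col q) (col q₂) x≢y x≢z y≢z c₀≢c₁ c₀≢c₂ c₁≢c₂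
                                       xq₁ xq xq₂ yq₁ yq yq₂ zq₁ zq zq₂))
      where
        5≰3 : ¬ (5 ≤ 3)
        5≰3 (s≤s (s≤s (s≤s ())))
        c₀≢c₁ : ¬ (col q₁ ≡ col q)
        c₀≢c₁ e = true≢false (trans (sym zq₁) (trans (cong (A z) e) zq))
        c₁≢c₂ : ¬ (col q ≡ col q₂)
        c₁≢c₂ e = true≢false (trans (sym zq₂) (trans (cong (A z) (sym e)) zq))
        c₀≢c₂ : ¬ (col q₁ ≡ col q₂)
        c₀≢c₂ e = no-rectangle x y (col q) (col q₂) x≢y c₁≢c₂ xq (subst (λ c → A x c ≡ true) e xq₁) yq yq₂

    differ : ∀ {u w c} → A u c ≡ true → A w c ≡ false → ¬ (u ≡ w)
    differ on off refl = true≢false (trans (sym on) off)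

    absurd : ⊥
    absurd =
      some-chord-misses 0 λ { (x , cx , _) → let (_ , a , _ , _ , _ , xa , _) = cx in
      some-chord-misses a λ { (y , cy , ya) →
      chords-meet x y cx cy λ { (q , xq , yq) →
      some-chord-misses q λ { (z , cz , zq) →
      chords-meet x z cx cz λ { (q₁ , xq₁ , zq₁) →
      chords-meet y z cy cz λ { (q₂ , yq₂ , zq₂) →
      no-chord-triangle x y z q₁ q q₂ (differ xa ya) (differ xq zq) (differ yq zq) xq₁ xq yq yq₂ zq₁ zq zq₂ } } } } } }

no-odd-C : ∀ {m n} (A : Matrix m n) → Linear A → gAtLeast A 5 → NoOddHoleAfterDeletion A →
           ∀ L → 3 ≤ L → isOdd L ≡ true → HasC A L → ⊥
no-odd-C A linear g≥5 no-odd-hole = <-rec (λ L → 3 ≤ L → isOdd L ≡ true → HasC A L → ⊥) step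
  where
    step : ∀ L → (∀ {L′} → L′ < L → 3 ≤ L′ → isOdd L′ ≡ true → HasC A L′ → ⊥) → 3 ≤ L → isOdd L ≡ true → HasC A L → ⊥
    step (suc L₀) shorter 3≤L L-odd C =
      MinimalOddCycle.Conclusion.absurd A linear L₀ (Cycles.HasC⇒PeriodicCycle A L₀ C) L-odd
        (g≥5 (suc L₀) 3≤L (isOdd⇒Odd _ L-odd) C) (λ L′ L′<L → shorter L′<L) g≥5 no-odd-hole

proposition5 : (m n : ℕ) (A : Matrix m n) → Linear A → gAtLeast A 5 → ¬ HasOddHole (IG A) →
    (Balanced A ⇔ (∀ (j : Fin n) (D : Subset m) → D ⊆ R A j → ∣ D ∣ ≡ ∣ R A j ∣ ∸ 2 →
    ¬ HasOddHole (IGrows A (∁ D))))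
proposition5 m n A linear g≥5 _ =
  mk⇔ (λ balanced j D _ _ → Forward.Balanced⇒no-odd-hole A balanced (∁ D))
      (λ no-odd-hole → no-odd-C⇒Balanced A (no-odd-C A linear g≥5 no-odd-hole))
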